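{- For every integer $j\ge 0$, with $i^2=-1$, \[ i^j F_{j+1}=2^{j}\sum_{m=0}^{\lfloor j/2\rfloor}\frac{(-1)^{m+1}\binom{j}{m}(-j+2m-1)\,F_{j-2m+1}\!\left(\tfrac{i}{2}\right)}{j-m+1}\;{}_{2}F_{1}\!\left(\begin{matrix}-m,\ -j+m-1\\ -j\end{matrix}\,\Big|\,-\tfrac14\right), \] \[ (-i)^j F_{3j+3}=2^{j+1}\sum_{m=0}^{\lfloor j/2\rfloor}\frac{(-1)^{m+1}\binom{j}{m}(-j+2m-1)\,F_{j-2m+1}(-2i)}{j-m+1}\;{}_{2}F_{1}\!\left(\begin{matrix}-m,\ -j+m-1\\ -j\end{matrix}\,\Big|\,-\tfrac14\right). \]
   Context: The Fibonacci polynomials are defined by $F_0(x)=0$, $F_1(x)=1$, $F_{n+2}(x)=xF_{n+1}(x)+F_n(x)$, evaluated here at complex arguments; $F_n=F_n(1)$ is the $n$-th Fibonacci number. For a nonnegative integer $m$, ${}_2F_1\!\left(\begin{smallmatrix}-m,\ b\\ c\end{smallmatrix}\big|z\right)=\sum_{k=0}^{m}\frac{(-m)_k(b)_k}{(c)_k\,k!}z^k$, where $(a)_k=a(a+1)\cdots(a+k-1)$. -}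

module Defs where

open import Data.Nat as ℕ using (ℕ; zero; suc; _∸_; _!)
open import Data.Nat.Combinatorics using (_C_)
open import Data.Integer as ℤ using (ℤ; +_)
open import Data.Rational as ℚ using (ℚ; 0ℚ; 1ℚ; ≢-nonZero)
open import Data.Rational.Properties using (_≟_)
open import Relation.Nullary using (yes; no)

ofℕ : ℕ → ℚ
ofℕ n = + n ℚ./ 1

-- Total inverse on ℚ (convention 0⁻¹ = 0); only ever applied to nonzero values here.
inv : ℚ → ℚ
inv q with q ≟ 0ℚ
... | yes _ = 0ℚ
... | no q≢0 = ℚ.1/_ q {{≢-nonZero q≢0}}

record ℚi : Set where
  constructor _+_i
  field
    re : ℚ
    im : ℚ
open ℚi public

infixl 6 _⊕_
infixl 7 _⊗_

_⊕_ : ℚi → ℚi → ℚi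
(a + b i) ⊕ (c + d i) = (a ℚ.+ c) + (b ℚ.+ d) i

_⊗_ : ℚi → ℚi → ℚi
(a + b i) ⊗ (c + d i) = (a ℚ.* c ℚ.- b ℚ.* d) + (a ℚ.* d ℚ.+ b ℚ.* c) i

ι : ℚ → ℚi
ι q = q + 0ℚ i

𝟘 𝟙 𝕚 : ℚi
𝟘 = ι 0ℚ
𝟙 = ι 1ℚ
𝕚 = 0ℚ + 1ℚ i

-ᶜ_ : ℚi → ℚi
-ᶜ (a + b i) = (ℚ.- a) + (ℚ.- b) i

_^ᶜ_ : ℚi → ℕ → ℚi
z ^ᶜ zero = 𝟙
z ^ᶜ suc n = z ⊗ (z ^ᶜ n)

sumTo : ℕ → (ℕ → ℚi) → ℚi
sumTo zero f = f 0
sumTo (suc n) f = sumTo n f ⊕ f (suc n)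

fibPoly : ℕ → ℚi → ℚi
fibPoly 0 x = 𝟘
fibPoly 1 x = 𝟙
fibPoly (suc (suc n)) x = x ⊗ fibPoly (suc n) x ⊕ fibPoly n x

fib : ℕ → ℚi
fib n = fibPoly n 𝟙

poch : ℚ → ℕ → ℚ
poch a zero = 1ℚ
poch a (suc k) = poch a k ℚ.* (a ℚ.+ ofℕ k)

sumToℚ : ℕ → (ℕ → ℚ) → ℚ
sumToℚ zero f = f 0
sumToℚ (suc n) f = sumToℚ n f ℚ.+ f (suc n)

powℚ : ℚ → ℕ → ℚ
powℚ z zero = 1ℚ
powℚ z (suc n) = z ℚ.* powℚ z n

hyp2F1 : ℕ → ℚ → ℚ → ℚ → ℚ
hyp2F1 m b c z = sumToℚ m λ k →
  poch (ℚ.- ofℕ m) k ℚ.* poch b k ℚ.* powℚ z k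
    ℚ.* inv (poch c k ℚ.* ofℕ (k !))

coeff : ℕ → ℕ → ℚ
coeff j m =
  ((ℤ.- ℤ.1ℤ) ℤ.^ suc m ℤ.* + (j C m) ℤ.* ((ℤ.- + j) ℤ.+ + (2 ℕ.* m) ℤ.- ℤ.1ℤ))
    ℚ./ suc (j ∸ m)
  ℚ.* hyp2F1 m ((ℚ.- ofℕ j) ℚ.+ ofℕ m ℚ.- 1ℚ) (ℚ.- ofℕ j) (ℚ.- (ℤ.1ℤ ℚ./ 4))

module Submission where

-- Let S x j = Σ_m coeff j m · F_{j−2m+1}(x).  Both identities say that 2^j · S x j = U_j(x), the
-- Chebyshev polynomial of the second kind, at x = i/2 and x = −2i, where its recurrence
-- U_{j+2} = 2x U_{j+1} − U_j is the one satisfied by i^j F_{j+1}, resp. (−i)^j F_{3j+3} / 2.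
-- So it suffices that S x (j+2) = x · S x (j+1) − S x j / 4.  Expanding
-- 2^{−j} U_j(x) = Σ_k C(j−k,k) (−1/4)^k x^{j−2k} and every power of x in the basis of Fibonacci
-- polynomials writes the coefficient of F_{s+1} as a double sum; its inner sum is the terminating
-- ₂F₁ in coeff (compare the ratios of consecutive terms), and Pascal's rule together with the
-- ballot-number recurrence gives the recurrence of these coefficients, hence of S.

open import Level using (0ℓ)
open import Data.Maybe.Base using (Maybe; just; nothing)
open import Data.Product using (_,_)
open import Relation.Nullary using (Dec; yes; no; ¬_; contradiction)
open import Relation.Binary.PropositionalEquality
import Tactic.RingSolver.Core.AlmostCommutativeRing as ACR
import Tactic.RingSolver as Ring

open import Defs

module Rational where

  open import Data.Nat as ℕ using (ℕ; zero; suc)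
  import Data.Nat.Properties as ℕ
  open import Data.Integer as ℤ using (ℤ; +_; -[1+_])
  import Data.Integer.Properties as ℤ
  import Data.Nat.Coprimality as Coprime
  open import Data.Rational as ℚ using (ℚ; mkℚ; 0ℚ; 1ℚ; _+_; _*_; -_; ≢-nonZero)
  open import Data.Rational.Properties
    using (+-*-commutativeRing; _≟_; ↥p/↧p≡p; /-cong; *-inverseʳ; *-zeroˡ; *-zeroʳ;
           *-identityˡ; *-identityʳ; *-assoc)
  open ≡-Reasoning

  ringℚ : ACR.AlmostCommutativeRing 0ℓ 0ℓ
  ringℚ = ACR.fromCommutativeRing +-*-commutativeRing isZero
    where
    isZero : ∀ q → Maybe (0ℚ ≡ q)
    isZero q with 0ℚ ≟ q
    ... | yes q≡0 = just q≡0
    ... | no _ = nothing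

  fromℤ : ℤ → ℚ
  fromℤ w = w ℚ./ 1

  private
    fromℤ≡mkℚ : ∀ w → fromℤ w ≡ mkℚ w 0 (Coprime.sym (Coprime.1-coprimeTo ℤ.∣ w ∣))
    fromℤ≡mkℚ w = ↥p/↧p≡p (mkℚ w 0 _)

  fromℤ-+ : ∀ a b → fromℤ (a ℤ.+ b) ≡ fromℤ a + fromℤ b
  fromℤ-+ a b rewrite fromℤ≡mkℚ a | fromℤ≡mkℚ b =
    /-cong (cong₂ ℤ._+_ (sym (ℤ.*-identityʳ a)) (sym (ℤ.*-identityʳ b))) refl

  fromℤ-* : ∀ a b → fromℤ (a ℤ.* b) ≡ fromℤ a * fromℤ b
  fromℤ-* a b rewrite fromℤ≡mkℚ a | fromℤ≡mkℚ b = refl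

  fromℤ-neg : ∀ a → fromℤ (ℤ.- a) ≡ - fromℤ a
  fromℤ-neg a rewrite fromℤ≡mkℚ a | fromℤ≡mkℚ (ℤ.- a) = neg-mkℚ a
    where
    neg-mkℚ : ∀ a → mkℚ (ℤ.- a) 0 (Coprime.sym (Coprime.1-coprimeTo ℤ.∣ ℤ.- a ∣))
                  ≡ - mkℚ a 0 (Coprime.sym (Coprime.1-coprimeTo ℤ.∣ a ∣))
    neg-mkℚ (+ zero) = refl
    neg-mkℚ (+ suc n) = refl
    neg-mkℚ -[1+ n ] = refl

  fromℤ-^ : ∀ a n → fromℤ (a ℤ.^ n) ≡ powℚ (fromℤ a) n
  fromℤ-^ a zero = refl
  fromℤ-^ a (suc n) = trans (fromℤ-* a (a ℤ.^ n)) (cong (fromℤ a *_) (fromℤ-^ a n))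

  ofℕ-+ : ∀ a b → ofℕ (a ℕ.+ b) ≡ ofℕ a + ofℕ b
  ofℕ-+ a b = trans (cong fromℤ (ℤ.pos-+ a b)) (fromℤ-+ (+ a) (+ b))

  ofℕ-* : ∀ a b → ofℕ (a ℕ.* b) ≡ ofℕ a * ofℕ b
  ofℕ-* a b = trans (cong fromℤ (ℤ.pos-* a b)) (fromℤ-* (+ a) (+ b))

  ofℕ-suc≢0 : ∀ n → ¬ ofℕ (suc n) ≡ 0ℚ
  ofℕ-suc≢0 n eq with trans (sym (fromℤ≡mkℚ (+ suc n))) eq
  ... | ()

  /suc≡*inv : ∀ w d → w ℚ./ suc d ≡ fromℤ w * inv (ofℕ (suc d))
  /suc≡*inv w d rewrite fromℤ≡mkℚ w | fromℤ≡mkℚ (+ suc d) =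
    /-cong (sym (ℤ.*-identityʳ w)) (sym (ℕ.+-identityʳ (suc d)))

  inv-inverseʳ : ∀ {a} → ¬ a ≡ 0ℚ → a * inv a ≡ 1ℚ
  inv-inverseʳ {a} a≢0 with a ≟ 0ℚ
  ... | yes a≡0 = contradiction a≡0 a≢0
  ... | no a≢0′ = *-inverseʳ a {{≢-nonZero a≢0′}}

  inv-unique : ∀ {a x} → ¬ a ≡ 0ℚ → a * x ≡ 1ℚ → x ≡ inv a
  inv-unique {a} {x} a≢0 ax≡1 = begin
    x                ≡⟨ sym (*-identityʳ x) ⟩
    x * 1ℚ           ≡⟨ cong (x *_) (sym (inv-inverseʳ a≢0)) ⟩
    x * (a * inv a)  ≡⟨ reassoc x a (inv a) ⟩
    (a * x) * inv a  ≡⟨ cong (_* inv a) ax≡1 ⟩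
    1ℚ * inv a       ≡⟨ *-identityˡ (inv a) ⟩
    inv a            ∎
    where
    reassoc : ∀ x a y → x * (a * y) ≡ (a * x) * y
    reassoc = Ring.solve-∀ ringℚ

  *-≢0 : ∀ {a b} → ¬ a ≡ 0ℚ → ¬ b ≡ 0ℚ → ¬ a * b ≡ 0ℚ
  *-≢0 {a} {b} a≢0 b≢0 ab≡0 = a≢0 (begin
    a                ≡⟨ sym (*-identityʳ a) ⟩
    a * 1ℚ           ≡⟨ cong (a *_) (sym (inv-inverseʳ b≢0)) ⟩
    a * (b * inv b)  ≡⟨ sym (*-assoc a b (inv b)) ⟩
    (a * b) * inv b  ≡⟨ cong (_* inv b) ab≡0 ⟩
    0ℚ * inv b       ≡⟨ *-zeroˡ (inv b) ⟩
    0ℚ               ∎)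

  inv-* : ∀ a b → inv (a * b) ≡ inv a * inv b
  inv-* a b = by-cases (a ≟ 0ℚ) (b ≟ 0ℚ)
    where
    by-cases : Dec (a ≡ 0ℚ) → Dec (b ≡ 0ℚ) → inv (a * b) ≡ inv a * inv b
    by-cases (yes refl) _ = trans (cong inv (*-zeroˡ b)) (sym (*-zeroˡ (inv b)))
    by-cases (no _) (yes refl) = trans (cong inv (*-zeroʳ a)) (sym (*-zeroʳ (inv a)))
    by-cases (no a≢0) (no b≢0) = sym (inv-unique (*-≢0 a≢0 b≢0) (begin
      (a * b) * (inv a * inv b)  ≡⟨ interchange a b (inv a) (inv b) ⟩
      (a * inv a) * (b * inv b)  ≡⟨ cong₂ _*_ (inv-inverseʳ a≢0) (inv-inverseʳ b≢0) ⟩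
      1ℚ                         ∎))
      where
      interchange : ∀ a b c d → (a * b) * (c * d) ≡ (a * c) * (b * d)
      interchange = Ring.solve-∀ ringℚ

  inv-neg : ∀ a → inv (- a) ≡ - inv a
  inv-neg a = begin
    inv (- a)             ≡⟨ cong inv (neg≡-1* a) ⟩
    inv (- 1ℚ * a)        ≡⟨ inv-* (- 1ℚ) a ⟩
    inv (- 1ℚ) * inv a    ≡⟨ sym (neg≡-1* (inv a)) ⟩
    - inv a               ∎
    where
    neg≡-1* : ∀ x → - x ≡ - 1ℚ * x
    neg≡-1* = Ring.solve-∀ ringℚ

  *-inv-transpose : ∀ {x y p q} → ¬ q ≡ 0ℚ → x * q ≡ y * p → x ≡ y * (p * inv q)
  *-inv-transpose {x} {y} {p} {q} q≢0 xq≡yp = begin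
    x                  ≡⟨ sym (*-identityʳ x) ⟩
    x * 1ℚ             ≡⟨ cong (x *_) (sym (inv-inverseʳ q≢0)) ⟩
    x * (q * inv q)    ≡⟨ sym (*-assoc x q (inv q)) ⟩
    x * q * inv q      ≡⟨ cong (_* inv q) xq≡yp ⟩
    y * p * inv q      ≡⟨ *-assoc y p (inv q) ⟩
    y * (p * inv q)    ∎

module Gaussian where

  open Rational using (ringℚ)
  open import Data.Rational as ℚ using (ℚ; 0ℚ; 1ℚ; _+_; _*_; _-_; -_)
  import Data.Rational.Properties as ℚ
  open import Algebra.Structures {A = ℚi} _≡_ using (IsCommutativeRing)
  open import Algebra.Bundles using (CommutativeRing)

  ⊕-assoc : ∀ x y z → (x ⊕ y) ⊕ z ≡ x ⊕ (y ⊕ z)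
  ⊕-assoc (a + b i) (c + d i) (e + f i) = cong₂ _+_i (ℚ.+-assoc a c e) (ℚ.+-assoc b d f)

  ⊕-comm : ∀ x y → x ⊕ y ≡ y ⊕ x
  ⊕-comm (a + b i) (c + d i) = cong₂ _+_i (ℚ.+-comm a c) (ℚ.+-comm b d)

  ⊕-identityˡ : ∀ x → 𝟘 ⊕ x ≡ x
  ⊕-identityˡ (a + b i) = cong₂ _+_i (ℚ.+-identityˡ a) (ℚ.+-identityˡ b)

  ⊕-inverseˡ : ∀ x → (-ᶜ x) ⊕ x ≡ 𝟘
  ⊕-inverseˡ (a + b i) = cong₂ _+_i (ℚ.+-inverseˡ a) (ℚ.+-inverseˡ b)

  ⊗-assoc : ∀ x y z → (x ⊗ y) ⊗ z ≡ x ⊗ (y ⊗ z)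
  ⊗-assoc (a + b i) (c + d i) (e + f i) = cong₂ _+_i (re-part a b c d e f) (im-part a b c d e f)
    where
    re-part : ∀ a b c d e f →
      (a * c - b * d) * e - (a * d + b * c) * f ≡ a * (c * e - d * f) - b * (c * f + d * e)
    re-part = Ring.solve-∀ ringℚ
    im-part : ∀ a b c d e f →
      (a * c - b * d) * f + (a * d + b * c) * e ≡ a * (c * f + d * e) + b * (c * e - d * f)
    im-part = Ring.solve-∀ ringℚ

  ⊗-comm : ∀ x y → x ⊗ y ≡ y ⊗ x
  ⊗-comm (a + b i) (c + d i) = cong₂ _+_i (re-part a b c d) (im-part a b c d)
    where
    re-part : ∀ a b c d → a * c - b * d ≡ c * a - d * b
    re-part = Ring.solve-∀ ringℚ
    im-part : ∀ a b c d → a * d + b * c ≡ c * b + d * a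
    im-part = Ring.solve-∀ ringℚ

  ⊗-identityˡ : ∀ x → 𝟙 ⊗ x ≡ x
  ⊗-identityˡ (a + b i) = cong₂ _+_i (re-part a b) (im-part a b)
    where
    re-part : ∀ a b → 1ℚ * a - 0ℚ * b ≡ a
    re-part = Ring.solve-∀ ringℚ
    im-part : ∀ a b → 1ℚ * b + 0ℚ * a ≡ b
    im-part = Ring.solve-∀ ringℚ

  ⊗-distribˡ-⊕ : ∀ x y z → x ⊗ (y ⊕ z) ≡ (x ⊗ y) ⊕ (x ⊗ z)
  ⊗-distribˡ-⊕ (a + b i) (c + d i) (e + f i) = cong₂ _+_i (re-part a b c d e f) (im-part a b c d e f)
    where
    re-part : ∀ a b c d e f → a * (c + e) - b * (d + f) ≡ (a * c - b * d) + (a * e - b * f)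
    re-part = Ring.solve-∀ ringℚ
    im-part : ∀ a b c d e f → a * (d + f) + b * (c + e) ≡ (a * d + b * c) + (a * f + b * e)
    im-part = Ring.solve-∀ ringℚ

  ℚi-isCommutativeRing : IsCommutativeRing _⊕_ _⊗_ -ᶜ_ 𝟘 𝟙
  ℚi-isCommutativeRing = record
    { isRing = record
      { +-isAbelianGroup = record
        { isGroup = record
          { isMonoid = record
            { isSemigroup = record
              { isMagma = record { isEquivalence = isEquivalence ; ∙-cong = cong₂ _⊕_ }
              ; assoc = ⊕-assoc }
            ; identity = ⊕-identityˡ , λ x → trans (⊕-comm x 𝟘) (⊕-identityˡ x) }
          ; inverse = ⊕-inverseˡ , λ x → trans (⊕-comm x (-ᶜ x)) (⊕-inverseˡ x)
          ; ⁻¹-cong = cong -ᶜ_ }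
        ; comm = ⊕-comm }
      ; *-cong = cong₂ _⊗_
      ; *-assoc = ⊗-assoc
      ; *-identity = ⊗-identityˡ , λ x → trans (⊗-comm x 𝟙) (⊗-identityˡ x)
      ; distrib = ⊗-distribˡ-⊕ , λ x y z → trans (⊗-comm (y ⊕ z) x)
          (trans (⊗-distribˡ-⊕ x y z) (cong₂ _⊕_ (⊗-comm x y) (⊗-comm x z))) }
    ; *-comm = ⊗-comm }

  ℚi-commutativeRing : CommutativeRing 0ℓ 0ℓ
  ℚi-commutativeRing = record { isCommutativeRing = ℚi-isCommutativeRing }

  ringℚi : ACR.AlmostCommutativeRing 0ℓ 0ℓ
  ringℚi = ACR.fromCommutativeRing ℚi-commutativeRing isZero
    where
    isZero : ∀ x → Maybe (𝟘 ≡ x)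
    isZero (a + b i) with 0ℚ ℚ.≟ a | 0ℚ ℚ.≟ b
    ... | yes refl | yes refl = just refl
    ... | _ | _ = nothing

  ι-* : ∀ a b → ι (a * b) ≡ ι a ⊗ ι b
  ι-* a b = sym (cong₂ _+_i (re-part a b) (im-part a b))
    where
    re-part : ∀ a b → a * b - 0ℚ * 0ℚ ≡ a * b
    re-part = Ring.solve-∀ ringℚ
    im-part : ∀ a b → a * 0ℚ + 0ℚ * b ≡ 0ℚ
    im-part = Ring.solve-∀ ringℚ

module Binomial where

  open import Data.Nat
  open import Data.Nat.Properties
  open import Data.Nat.Combinatorics using (_C_; nCk+nC[k+1]≡[n+1]C[k+1]; nC1≡n)
  open import Data.Nat.Tactic.RingSolver using (solve-∀)
  open ≡-Reasoning

  [1+n]C[1+k]*[1+k]≡nCk*[1+n] : ∀ n k → (suc n C suc k) * suc k ≡ (n C k) * suc n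
  [1+n]C[1+k]*[1+k]≡nCk*[1+n] n zero = begin
    (suc n C 1) * 1  ≡⟨ *-identityʳ (suc n C 1) ⟩
    suc n C 1        ≡⟨ nC1≡n (suc n) ⟩
    suc n            ≡⟨ sym (*-identityˡ (suc n)) ⟩
    1 * suc n        ∎
  [1+n]C[1+k]*[1+k]≡nCk*[1+n] zero (suc k) = refl
  [1+n]C[1+k]*[1+k]≡nCk*[1+n] (suc n) (suc k) = begin
    (suc (suc n) C suc (suc k)) * suc (suc k)   ≡⟨ cong (_* suc (suc k)) (sym (nCk+nC[k+1]≡[n+1]C[k+1] (suc n) (suc k))) ⟩
    (a + b) * suc (suc k)                       ≡⟨ expand a b k ⟩
    a * suc k + b * suc (suc k) + a             ≡⟨ cong₂ (λ x y → x + y + a)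
                                                     ([1+n]C[1+k]*[1+k]≡nCk*[1+n] n k)
                                                     ([1+n]C[1+k]*[1+k]≡nCk*[1+n] n (suc k)) ⟩
    (n C k) * suc n + (n C suc k) * suc n + a   ≡⟨ collect (n C k) (n C suc k) a n ⟩
    (n C k + n C suc k) * suc n + a             ≡⟨ cong (λ x → x * suc n + a) (nCk+nC[k+1]≡[n+1]C[k+1] n k) ⟩
    a * suc n + a                               ≡⟨ *-suc-comm a n ⟩
    a * suc (suc n)                             ∎
    where
    a = suc n C suc k
    b = suc n C suc (suc k)
    expand : ∀ a b k → (a + b) * suc (suc k) ≡ a * suc k + b * suc (suc k) + a
    expand = solve-∀
    collect : ∀ c d a n → c * suc n + d * suc n + a ≡ (c + d) * suc n + a
    collect = solve-∀
    *-suc-comm : ∀ a n → a * suc n + a ≡ a * suc (suc n)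
    *-suc-comm = solve-∀

  [1+k+r]C[1+k]*[1+k]≡[1+k+r]Ck*[1+r] : ∀ k r → (suc (k + r) C suc k) * suc k ≡ (suc (k + r) C k) * suc r
  [1+k+r]C[1+k]*[1+k]≡[1+k+r]Ck*[1+r] k r = +-cancelˡ-≡ (c * suc k) _ _ (begin
    c * suc k + d * suc k          ≡⟨ sym (*-distribʳ-+ (suc k) c d) ⟩
    (c + d) * suc k                ≡⟨ cong (_* suc k) (nCk+nC[k+1]≡[n+1]C[k+1] n k) ⟩
    (suc n C suc k) * suc k        ≡⟨ [1+n]C[1+k]*[1+k]≡nCk*[1+n] n k ⟩
    c * suc n                      ≡⟨ split c k r ⟩
    c * suc k + c * suc r          ∎)
    where
    n = suc (k + r)
    c = n C k
    d = n C suc k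
    split : ∀ c k r → c * suc (suc (k + r)) ≡ c * suc k + c * suc r
    split = solve-∀

  [1+k+r]Ck*[1+r]≡[k+r]Ck*[1+k+r] : ∀ k r → (suc (k + r) C k) * suc r ≡ ((k + r) C k) * suc (k + r)
  [1+k+r]Ck*[1+r]≡[k+r]Ck*[1+k+r] k r =
    trans (sym ([1+k+r]C[1+k]*[1+k]≡[1+k+r]Ck*[1+r] k r)) ([1+n]C[1+k]*[1+k]≡nCk*[1+n] (k + r) k)

module Ballot where

  open import Data.Nat
  open import Data.Nat.Properties
  open import Data.Nat.Combinatorics using (_C_; nCk+nC[k+1]≡[n+1]C[k+1])
  open import Data.Nat.Tactic.RingSolver using (solve-∀)
  open Binomial
  open ≡-Reasoning

  -- (−1)^l · ballot l s is the coefficient of F_{s+1}(x) in x^{2l+s}.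
  ballot : ℕ → ℕ → ℕ
  ballot zero s = 1
  ballot (suc l) zero = ballot l 1
  ballot (suc l) (suc s) = ballot (suc l) s + ballot l (suc (suc s))

  private
    cross-multiply : ∀ d₁ d₂ a b l s →
      d₁ * suc (suc (l + s)) ≡ a * suc s →
      d₂ * suc (suc (suc (l + s))) ≡ b * suc (suc (suc s)) →
      a * suc l ≡ b * suc (suc (l + s)) →
      (d₁ + d₂) * suc (suc (suc (l + s))) ≡ (a + b) * suc (suc s)
    cross-multiply d₁ d₂ a b l s h₁ h₂ h₃ = *-cancelʳ-≡ _ _ (suc l * p) (begin
      (d₁ + d₂) * q * (suc l * p)                    ≡⟨ e₁ d₁ d₂ l p q ⟩
      d₁ * p * (q * suc l) + d₂ * q * (suc l * p)    ≡⟨ cong₂ (λ x y → x * (q * suc l) + y * (suc l * p)) h₁ h₂ ⟩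
      a * suc s * (q * suc l) + b * suc (suc (suc s)) * (suc l * p)
                                                     ≡⟨ e₂ a b l s p q ⟩
      a * suc s * (q * suc l) + b * p * (suc (suc (suc s)) * suc l)
                                                     ≡⟨ cong (λ x → a * suc s * (q * suc l) + x * (suc (suc (suc s)) * suc l)) (sym h₃) ⟩
      a * suc s * (q * suc l) + a * suc l * (suc (suc (suc s)) * suc l)
                                                     ≡⟨ e₃ a l s ⟩
      a * suc (suc s) * (suc l * p) + a * suc l * (suc (suc s) * suc l)
                                                     ≡⟨ cong (λ x → a * suc (suc s) * (suc l * p) + x * (suc (suc s) * suc l)) h₃ ⟩
      a * suc (suc s) * (suc l * p) + b * p * (suc (suc s) * suc l)
                                                     ≡⟨ e₄ a b l s p ⟩
      (a + b) * suc (suc s) * (suc l * p)            ∎)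
      where
      p = suc (suc (l + s))
      q = suc p
      e₁ : ∀ d₁ d₂ l p q → (d₁ + d₂) * q * (suc l * p) ≡ d₁ * p * (q * suc l) + d₂ * q * (suc l * p)
      e₁ = solve-∀
      e₂ : ∀ a b l s p q → a * suc s * (q * suc l) + b * suc (suc (suc s)) * (suc l * p)
                           ≡ a * suc s * (q * suc l) + b * p * (suc (suc (suc s)) * suc l)
      e₂ = solve-∀
      e₃ : ∀ a l s → a * suc s * (suc (suc (suc (l + s))) * suc l) + a * suc l * (suc (suc (suc s)) * suc l)
                     ≡ a * suc (suc s) * (suc l * suc (suc (l + s))) + a * suc l * (suc (suc s) * suc l)
      e₃ = solve-∀
      e₄ : ∀ a b l s p → a * suc (suc s) * (suc l * p) + b * p * (suc (suc s) * suc l)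
                         ≡ (a + b) * suc (suc s) * (suc l * p)
      e₄ = solve-∀

  ballot-closed : ∀ l s → ballot l s * suc (l + s) ≡ ((l + (l + s)) C l) * suc s
  ballot-closed zero s = refl
  ballot-closed (suc l) zero = begin
    ballot l 1 * suc (suc l + 0)            ≡⟨ cong (λ x → ballot l 1 * suc x) (+-comm (suc l) 0) ⟩
    ballot l 1 * suc (suc l)                ≡⟨ cong (λ x → ballot l 1 * suc x) (+-comm 1 l) ⟩
    ballot l 1 * suc (l + 1)                ≡⟨ ballot-closed l 1 ⟩
    (n C l) * 2                             ≡⟨ sym (*-identityʳ _) ⟩
    (n C l) * 2 * 1                         ≡⟨ cong (_* 1) central ⟩
    (suc n C suc l) * 1                     ≡⟨ cong (λ x → (x C suc l) * 1) (index l) ⟩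
    ((suc l + (suc l + 0)) C suc l) * 1     ∎
    where
    n = l + (l + 1)
    index : ∀ l → suc (l + (l + 1)) ≡ suc l + (suc l + 0)
    index = solve-∀
    double : ∀ c l → c * suc (l + (l + 1)) ≡ c * 2 * suc l
    double = solve-∀
    central : (n C l) * 2 ≡ suc n C suc l
    central = *-cancelʳ-≡ _ _ (suc l)
      (sym (trans ([1+n]C[1+k]*[1+k]≡nCk*[1+n] n l) (double (n C l) l)))
  ballot-closed (suc l) (suc s) = begin
    (ballot (suc l) s + ballot l (suc (suc s))) * suc (suc l + suc s)
        ≡⟨ cong (λ x → (ballot (suc l) s + ballot l (suc (suc s))) * suc x) (index₁ l s) ⟩
    (ballot (suc l) s + ballot l (suc (suc s))) * suc (suc (suc (l + s)))
        ≡⟨ cross-multiply (ballot (suc l) s) (ballot l (suc (suc s))) (N C suc l) (N C l) l s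
             (trans (ballot-closed (suc l) s) (cong (λ x → (x C suc l) * suc s) (index₂ l s)))
             (trans (cong (λ x → ballot l (suc (suc s)) * suc x) (sym (index₃ l s)))
                    (ballot-closed l (suc (suc s))))
             (subst (λ x → (x C suc l) * suc l ≡ (x C l) * suc (suc (l + s))) (index₄ l s)
                    ([1+k+r]C[1+k]*[1+k]≡[1+k+r]Ck*[1+r] l (suc (l + s)))) ⟩
    (N C suc l + N C l) * suc (suc s)
        ≡⟨ cong (_* suc (suc s)) (trans (+-comm (N C suc l) (N C l)) (nCk+nC[k+1]≡[n+1]C[k+1] N l)) ⟩
    (suc N C suc l) * suc (suc s)
        ≡⟨ cong (λ x → (x C suc l) * suc (suc s)) (index₅ l s) ⟩
    ((suc l + (suc l + suc s)) C suc l) * suc (suc s)   ∎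
    where
    N = l + (l + suc (suc s))
    index₁ : ∀ l s → suc l + suc s ≡ suc (suc (l + s))
    index₁ = solve-∀
    index₂ : ∀ l s → suc l + (suc l + s) ≡ l + (l + suc (suc s))
    index₂ = solve-∀
    index₃ : ∀ l s → l + suc (suc s) ≡ suc (suc (l + s))
    index₃ = solve-∀
    index₄ : ∀ l s → suc (l + suc (l + s)) ≡ l + (l + suc (suc s))
    index₄ = solve-∀
    index₅ : ∀ l s → suc (l + (l + suc (suc s))) ≡ suc l + (suc l + suc s)
    index₅ = solve-∀

  ballot-ratio : ∀ l s → let M = l + (l + s) in
    ballot (suc l) s * suc l * suc (suc (l + s)) ≡ ballot l s * suc (suc M) * suc M
  ballot-ratio l s = *-cancelʳ-≡ _ _ (suc (l + s)) (begin
    ballot (suc l) s * suc l * suc (suc (l + s)) * suc (l + s)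
        ≡⟨ e₁ (ballot (suc l) s) l s ⟩
    ballot (suc l) s * suc (suc l + s) * (suc l * suc (l + s))
        ≡⟨ cong (_* (suc l * suc (l + s))) (ballot-closed (suc l) s) ⟩
    ((suc l + (suc l + s)) C suc l) * suc s * (suc l * suc (l + s))
        ≡⟨ cong (λ x → (x C suc l) * suc s * (suc l * suc (l + s))) (index l s) ⟩
    (suc (suc M) C suc l) * suc s * (suc l * suc (l + s))
        ≡⟨ e₂ (suc (suc M) C suc l) l s ⟩
    (suc (suc M) C suc l) * suc l * (suc s * suc (l + s))
        ≡⟨ cong (_* (suc s * suc (l + s))) ([1+n]C[1+k]*[1+k]≡nCk*[1+n] (suc M) l) ⟩
    (suc M C l) * suc (suc M) * (suc s * suc (l + s))
        ≡⟨ e₃ (suc M C l) l s M ⟩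
    (suc M C l) * suc (l + s) * (suc (suc M) * suc s)
        ≡⟨ cong (_* (suc (suc M) * suc s)) ([1+k+r]Ck*[1+r]≡[k+r]Ck*[1+k+r] l (l + s)) ⟩
    (M C l) * suc M * (suc (suc M) * suc s)
        ≡⟨ e₄ (M C l) s M ⟩
    (M C l) * suc s * (suc (suc M) * suc M)
        ≡⟨ cong (_* (suc (suc M) * suc M)) (sym (ballot-closed l s)) ⟩
    ballot l s * suc (l + s) * (suc (suc M) * suc M)
        ≡⟨ e₅ (ballot l s) (l + s) M ⟩
    ballot l s * suc (suc M) * suc M * suc (l + s)  ∎)
    where
    M = l + (l + s)
    index : ∀ l s → suc l + (suc l + s) ≡ suc (suc (l + (l + s)))
    index = solve-∀
    e₁ : ∀ d l s → d * suc l * suc (suc (l + s)) * suc (l + s) ≡ d * suc (suc l + s) * (suc l * suc (l + s))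
    e₁ = solve-∀
    e₂ : ∀ c l s → c * suc s * (suc l * suc (l + s)) ≡ c * suc l * (suc s * suc (l + s))
    e₂ = solve-∀
    e₃ : ∀ c l s M → c * suc (suc M) * (suc s * suc (l + s)) ≡ c * suc (l + s) * (suc (suc M) * suc s)
    e₃ = solve-∀
    e₄ : ∀ c s M → c * suc M * (suc (suc M) * suc s) ≡ c * suc s * (suc (suc M) * suc M)
    e₄ = solve-∀
    e₅ : ∀ d t M → d * suc t * (suc (suc M) * suc M) ≡ d * suc (suc M) * suc M * suc t
    e₅ = solve-∀

  term-ratio : ∀ k l s → let M = l + (l + s) in
    (suc (k + M) C suc k) * ballot l s * suc (suc (k + M)) * suc k
      ≡ ((k + (suc l + (suc l + s))) C k) * ballot (suc l) s * suc l * suc (suc (l + s))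
  term-ratio k l s = begin
    (suc (k + M) C suc k) * d * suc (suc (k + M)) * suc k
        ≡⟨ e₁ (suc (k + M) C suc k) d k M ⟩
    (suc (k + M) C suc k) * suc k * (d * suc (suc (k + M)))
        ≡⟨ cong (_* (d * suc (suc (k + M)))) ([1+n]C[1+k]*[1+k]≡nCk*[1+n] (k + M) k) ⟩
    ((k + M) C k) * suc (k + M) * (d * suc (suc (k + M)))
        ≡⟨ cong (_* (d * suc (suc (k + M)))) (sym ([1+k+r]Ck*[1+r]≡[k+r]Ck*[1+k+r] k M)) ⟩
    (suc (k + M) C k) * suc M * (d * suc (suc (k + M)))
        ≡⟨ e₂ (suc (k + M) C k) d k M ⟩
    (suc (k + M) C k) * suc (k + suc M) * (d * suc M)
        ≡⟨ cong (λ x → (x C k) * suc (k + suc M) * (d * suc M)) (sym (+-suc k M)) ⟩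
    ((k + suc M) C k) * suc (k + suc M) * (d * suc M)
        ≡⟨ cong (_* (d * suc M)) (sym ([1+k+r]Ck*[1+r]≡[k+r]Ck*[1+k+r] k (suc M))) ⟩
    (suc (k + suc M) C k) * suc (suc M) * (d * suc M)
        ≡⟨ e₃ (suc (k + suc M) C k) d M ⟩
    (suc (k + suc M) C k) * (d * suc (suc M) * suc M)
        ≡⟨ cong₂ (λ x y → (x C k) * y) (index k l s) (sym (ballot-ratio l s)) ⟩
    ((k + (suc l + (suc l + s))) C k) * (ballot (suc l) s * suc l * suc (suc (l + s)))
        ≡⟨ e₄ ((k + (suc l + (suc l + s))) C k) (ballot (suc l) s) l s ⟩
    ((k + (suc l + (suc l + s))) C k) * ballot (suc l) s * suc l * suc (suc (l + s))  ∎
    where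
    M = l + (l + s)
    d = ballot l s
    index : ∀ k l s → suc (k + suc (l + (l + s))) ≡ k + (suc l + (suc l + s))
    index = solve-∀
    e₁ : ∀ c d k M → c * d * suc (suc (k + M)) * suc k ≡ c * suc k * (d * suc (suc (k + M)))
    e₁ = solve-∀
    e₂ : ∀ c d k M → c * suc M * (d * suc (suc (k + M))) ≡ c * suc (k + suc M) * (d * suc M)
    e₂ = solve-∀
    e₃ : ∀ c d M → c * suc (suc M) * (d * suc M) ≡ c * (d * suc (suc M) * suc M)
    e₃ = solve-∀
    e₄ : ∀ c d l s → c * (d * suc l * suc (suc (l + s))) ≡ c * d * suc l * suc (suc (l + s))
    e₄ = solve-∀

module Sums where

  open import Data.Nat as ℕ using (ℕ; zero; suc; _≤_; z≤n)
  import Data.Nat.Properties as ℕ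
  open import Data.Rational as ℚ using (ℚ; _+_; _*_; -_; _-_)
  import Data.Rational.Properties as ℚ
  open Rational using (ringℚ)

  sumToℚ-cong : ∀ n {f g : ℕ → ℚ} → (∀ {k} → k ≤ n → f k ≡ g k) → sumToℚ n f ≡ sumToℚ n g
  sumToℚ-cong zero f≗g = f≗g z≤n
  sumToℚ-cong (suc n) f≗g = cong₂ _+_ (sumToℚ-cong n (λ k≤n → f≗g (ℕ.m≤n⇒m≤1+n k≤n))) (f≗g ℕ.≤-refl)

  sumToℚ-*ˡ : ∀ a n f → a * sumToℚ n f ≡ sumToℚ n (λ k → a * f k)
  sumToℚ-*ˡ a zero f = refl
  sumToℚ-*ˡ a (suc n) f =
    trans (ℚ.*-distribˡ-+ a (sumToℚ n f) (f (suc n))) (cong (_+ a * f (suc n)) (sumToℚ-*ˡ a n f))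

  sumToℚ-+ : ∀ n f g → sumToℚ n (λ k → f k + g k) ≡ sumToℚ n f + sumToℚ n g
  sumToℚ-+ zero f g = refl
  sumToℚ-+ (suc n) f g =
    trans (cong (_+ (f (suc n) + g (suc n))) (sumToℚ-+ n f g))
      (interchange (sumToℚ n f) (sumToℚ n g) (f (suc n)) (g (suc n)))
    where
    interchange : ∀ a b c d → (a + b) + (c + d) ≡ (a + c) + (b + d)
    interchange = Ring.solve-∀ ringℚ

  sumToℚ-neg : ∀ n f → sumToℚ n (λ k → - f k) ≡ - sumToℚ n f
  sumToℚ-neg zero f = refl
  sumToℚ-neg (suc n) f =
    trans (cong (_+ - f (suc n)) (sumToℚ-neg n f)) (sym (ℚ.neg-distrib-+ (sumToℚ n f) (f (suc n))))

  sumToℚ-- : ∀ n f g → sumToℚ n (λ k → f k - g k) ≡ sumToℚ n f - sumToℚ n g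
  sumToℚ-- n f g = trans (sumToℚ-+ n f (λ k → - g k)) (cong (sumToℚ n f +_) (sumToℚ-neg n g))

  sumToℚ-suc : ∀ n f → sumToℚ (suc n) f ≡ f 0 + sumToℚ n (λ k → f (suc k))
  sumToℚ-suc zero f = refl
  sumToℚ-suc (suc n) f = trans (cong (_+ f (suc (suc n))) (sumToℚ-suc n f)) (ℚ.+-assoc (f 0) _ _)

module Hypergeometric where

  open import Data.Nat as ℕ using (ℕ; suc; _!)
  open import Data.Rational as ℚ using (ℚ; _+_; _*_; -_)
  open Rational
  open ≡-Reasoning

  hyp2F1-term : ℕ → ℚ → ℚ → ℚ → ℕ → ℚ
  hyp2F1-term m b c x k = poch (- ofℕ m) k * poch b k * powℚ x k * inv (poch c k * ofℕ (k !))

  hyp2F1-term-ratio : ∀ m b c x k → hyp2F1-term m b c x (suc k) ≡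
    hyp2F1-term m b c x k * ((- ofℕ m + ofℕ k) * (b + ofℕ k) * x * inv (c + ofℕ k) * inv (ofℕ (suc k)))
  hyp2F1-term-ratio m b c x k = begin
    P * u * (Q * v) * (x * X) * inv (R * w * ofℕ (suc k ℕ.* k !))
      ≡⟨ cong (λ y → P * u * (Q * v) * (x * X) * y) inv-split ⟩
    P * u * (Q * v) * (x * X) * ((inv R * inv w) * (inv (ofℕ (suc k)) * inv (ofℕ (k !))))
      ≡⟨ regroup P u Q v x X (inv R) (inv w) (inv (ofℕ (suc k))) (inv (ofℕ (k !))) ⟩
    P * Q * X * (inv R * inv (ofℕ (k !))) * (u * v * x * inv w * inv (ofℕ (suc k)))
      ≡⟨ cong (λ y → P * Q * X * y * (u * v * x * inv w * inv (ofℕ (suc k)))) (sym (inv-* R (ofℕ (k !)))) ⟩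
    P * Q * X * inv (R * ofℕ (k !)) * (u * v * x * inv w * inv (ofℕ (suc k)))  ∎
    where
    P = poch (- ofℕ m) k
    Q = poch b k
    R = poch c k
    X = powℚ x k
    u = - ofℕ m + ofℕ k
    v = b + ofℕ k
    w = c + ofℕ k
    inv-split : inv (R * w * ofℕ (suc k ℕ.* k !)) ≡ (inv R * inv w) * (inv (ofℕ (suc k)) * inv (ofℕ (k !)))
    inv-split = begin
      inv (R * w * ofℕ (suc k ℕ.* k !))                  ≡⟨ cong (λ y → inv (R * w * y)) (ofℕ-* (suc k) (k !)) ⟩
      inv (R * w * (ofℕ (suc k) * ofℕ (k !)))            ≡⟨ inv-* (R * w) _ ⟩
      inv (R * w) * inv (ofℕ (suc k) * ofℕ (k !))        ≡⟨ cong₂ _*_ (inv-* R w) (inv-* (ofℕ (suc k)) (ofℕ (k !))) ⟩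
      (inv R * inv w) * (inv (ofℕ (suc k)) * inv (ofℕ (k !)))  ∎
    regroup : ∀ P u Q v x X iR iw ik ik! →
      P * u * (Q * v) * (x * X) * ((iR * iw) * (ik * ik!)) ≡ P * Q * X * (iR * ik!) * (u * v * x * iw * ik)
    regroup = Ring.solve-∀ ringℚ

module Evaluation where

  open import Data.Nat as ℕ using (ℕ; zero; suc; _∸_)
  import Data.Nat.Properties as ℕ
  open import Data.Nat.Combinatorics using (_C_)
  open import Data.Nat.Tactic.RingSolver using (solve-∀)
  open import Data.Integer as ℤ using (+_)
  open import Data.Rational as ℚ using (ℚ; 1ℚ; _+_; _*_; -_; _-_)
  import Data.Rational.Properties as ℚ
  open Rational
  open Sums
  open Hypergeometric
  open Ballot
  open ≡-Reasoning

  z : ℚ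
  z = - (ℤ.1ℤ ℚ./ 4)

  -- The coefficient of F_{s+1}(x) contributed by the monomial C(j−k,k) z^k x^{j−2k} of 2^{−j} U_j(x),
  -- where j = 2(k+l)+s.
  uTerm : ℕ → ℕ → ℕ → ℚ
  uTerm k l s = powℚ z k * powℚ (- 1ℚ) l * ofℕ ((k ℕ.+ (l ℕ.+ (l ℕ.+ s))) C k) * ofℕ (ballot l s)

  uCoeff : ℕ → ℕ → ℚ
  uCoeff m s = sumToℚ m (λ k → uTerm k (m ∸ k) s)

  private
    ofℕ-*-*-* : ∀ a b c d → ofℕ (a ℕ.* b ℕ.* c ℕ.* d) ≡ ofℕ a * ofℕ b * ofℕ c * ofℕ d
    ofℕ-*-*-* a b c d = trans (ofℕ-* (a ℕ.* b ℕ.* c) d)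
      (cong (_* ofℕ d) (trans (ofℕ-* (a ℕ.* b) c) (cong (_* ofℕ c) (ofℕ-* a b))))

  uTerm-ratio : ∀ k l s → let Q = suc (suc (k ℕ.+ (l ℕ.+ (l ℕ.+ s)))) in
    uTerm (suc k) l s * (ofℕ Q * ofℕ (suc k))
      ≡ uTerm k (suc l) s * (- z * ofℕ (suc l) * ofℕ (suc (suc (l ℕ.+ s))))
  uTerm-ratio k l s = begin
    z * Z * S * c₁ * d₀ * (q * k₁)      ≡⟨ regroupˡ z Z S c₁ d₀ q k₁ ⟩
    z * Z * S * (c₁ * d₀ * q * k₁)      ≡⟨ cong (z * Z * S *_) ratio ⟩
    z * Z * S * (c₂ * d₁ * l₁ * l₂)     ≡⟨ regroupʳ z Z S c₂ d₁ l₁ l₂ ⟩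
    Z * (- 1ℚ * S) * c₂ * d₁ * (- z * l₁ * l₂)  ∎
    where
    M = l ℕ.+ (l ℕ.+ s)
    Z = powℚ z k
    S = powℚ (- 1ℚ) l
    c₁ = ofℕ (suc (k ℕ.+ M) C suc k)
    c₂ = ofℕ ((k ℕ.+ (suc l ℕ.+ (suc l ℕ.+ s))) C k)
    d₀ = ofℕ (ballot l s)
    d₁ = ofℕ (ballot (suc l) s)
    q = ofℕ (suc (suc (k ℕ.+ M)))
    k₁ = ofℕ (suc k)
    l₁ = ofℕ (suc l)
    l₂ = ofℕ (suc (suc (l ℕ.+ s)))
    ratio : c₁ * d₀ * q * k₁ ≡ c₂ * d₁ * l₁ * l₂
    ratio = begin
      c₁ * d₀ * q * k₁  ≡⟨ sym (ofℕ-*-*-* (suc (k ℕ.+ M) C suc k) (ballot l s) (suc (suc (k ℕ.+ M))) (suc k)) ⟩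
      ofℕ ((suc (k ℕ.+ M) C suc k) ℕ.* ballot l s ℕ.* suc (suc (k ℕ.+ M)) ℕ.* suc k)
                        ≡⟨ cong ofℕ (term-ratio k l s) ⟩
      ofℕ (((k ℕ.+ (suc l ℕ.+ (suc l ℕ.+ s))) C k) ℕ.* ballot (suc l) s ℕ.* suc l ℕ.* suc (suc (l ℕ.+ s)))
                        ≡⟨ ofℕ-*-*-* ((k ℕ.+ (suc l ℕ.+ (suc l ℕ.+ s))) C k) (ballot (suc l) s)
                                     (suc l) (suc (suc (l ℕ.+ s))) ⟩
      c₂ * d₁ * l₁ * l₂ ∎
    regroupˡ : ∀ z Z S c d q k → z * Z * S * c * d * (q * k) ≡ z * Z * S * (c * d * q * k)
    regroupˡ = Ring.solve-∀ ringℚ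
    regroupʳ : ∀ z Z S c d l l′ → z * Z * S * (c * d * l * l′) ≡ Z * (- 1ℚ * S) * c * d * (- z * l * l′)
    regroupʳ = Ring.solve-∀ ringℚ

  uTerm-suc : ∀ k l s → let Q = suc (suc (k ℕ.+ (l ℕ.+ (l ℕ.+ s)))) in
    uTerm (suc k) l s
      ≡ uTerm k (suc l) s * (- z * ofℕ (suc l) * ofℕ (suc (suc (l ℕ.+ s))) * inv (ofℕ Q * ofℕ (suc k)))
  uTerm-suc k l s =
    *-inv-transpose {y = uTerm k (suc l) s} {p = - z * ofℕ (suc l) * ofℕ (suc (suc (l ℕ.+ s)))}
      (*-≢0 (ofℕ-suc≢0 (suc (k ℕ.+ (l ℕ.+ (l ℕ.+ s))))) (ofℕ-suc≢0 k)) (uTerm-ratio k l s)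

  hyp-term : ℕ → ℕ → ℕ → ℚ
  hyp-term m s = let j = 2 ℕ.* m ℕ.+ s in hyp2F1-term m (- ofℕ j + ofℕ m - 1ℚ) (- ofℕ j) z

  prefactor : ℕ → ℕ → ℚ
  prefactor m s = let j = 2 ℕ.* m ℕ.+ s in
    ((ℤ.- ℤ.1ℤ) ℤ.^ suc m ℤ.* + (j C m) ℤ.* ((ℤ.- + j) ℤ.+ + (2 ℕ.* m) ℤ.- ℤ.1ℤ)) ℚ./ suc (j ∸ m)

  coeff≡prefactor*sum : ∀ m s → coeff (2 ℕ.* m ℕ.+ s) m ≡ prefactor m s * sumToℚ m (hyp-term m s)
  coeff≡prefactor*sum m s = refl

  private
    ofℕ-split : ∀ a b {c} → a ℕ.+ b ≡ c → ofℕ c ≡ ofℕ a + ofℕ b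
    ofℕ-split a b refl = ofℕ-+ a b

  hyp-term-ratio : ∀ k l s → let Q = suc (suc (k ℕ.+ (l ℕ.+ (l ℕ.+ s)))) in
    hyp-term (suc (k ℕ.+ l)) s (suc k)
      ≡ hyp-term (suc (k ℕ.+ l)) s k * (- z * ofℕ (suc l) * ofℕ (suc (suc (l ℕ.+ s))) * inv (ofℕ Q * ofℕ (suc k)))
  hyp-term-ratio k l s =
    trans (hyp2F1-term-ratio m b c z k) (cong (hyp-term m s k *_) (begin
      (- ofℕ m + ofℕ k) * (b + ofℕ k) * z * inv (c + ofℕ k) * inv K₁
        ≡⟨ cong₂ (λ x y → x * y * z * inv (c + ofℕ k) * inv K₁) m-eq b-eq ⟩
      (- L₁) * (- L₂) * z * inv (c + ofℕ k) * inv K₁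
        ≡⟨ cong (λ x → (- L₁) * (- L₂) * z * x * inv K₁) (trans (cong inv c-eq) (inv-neg Q)) ⟩
      (- L₁) * (- L₂) * z * (- inv Q) * inv K₁
        ≡⟨ regroup L₁ L₂ z (inv Q) (inv K₁) ⟩
      - z * L₁ * L₂ * (inv Q * inv K₁)
        ≡⟨ cong (- z * L₁ * L₂ *_) (sym (inv-* Q K₁)) ⟩
      - z * L₁ * L₂ * inv (Q * K₁)  ∎))
    where
    m = suc (k ℕ.+ l)
    j = 2 ℕ.* m ℕ.+ s
    b = - ofℕ j + ofℕ m - 1ℚ
    c = - ofℕ j
    L₁ = ofℕ (suc l)
    L₂ = ofℕ (suc (suc (l ℕ.+ s)))
    K₁ = ofℕ (suc k)
    Q = ofℕ (suc (suc (k ℕ.+ (l ℕ.+ (l ℕ.+ s)))))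
    m-eq : - ofℕ m + ofℕ k ≡ - L₁
    m-eq = trans (cong (λ x → - x + ofℕ k) (ofℕ-split k (suc l) (ℕ.+-suc k l))) (cancel (ofℕ k) L₁)
      where
      cancel : ∀ K L → - (K + L) + K ≡ - L
      cancel = Ring.solve-∀ ringℚ
    b-eq : b + ofℕ k ≡ - L₂
    b-eq = begin
      - ofℕ j + ofℕ m - 1ℚ + ofℕ k
        ≡⟨ cong (λ x → - x + ofℕ m - 1ℚ + ofℕ k) (trans (ofℕ-split (m ℕ.+ k) (suc (l ℕ.+ s)) (j-split k l s))
                                                         (cong (_+ ofℕ (suc (l ℕ.+ s))) (ofℕ-+ m k))) ⟩
      - (ofℕ m + ofℕ k + P) + ofℕ m - 1ℚ + ofℕ k
        ≡⟨ cancel (ofℕ m) (ofℕ k) P ⟩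
      - (1ℚ + P)
        ≡⟨ cong -_ (sym (ofℕ-+ 1 (suc (l ℕ.+ s)))) ⟩
      - L₂  ∎
      where
      P = ofℕ (suc (l ℕ.+ s))
      j-split : ∀ k l s → suc (k ℕ.+ l) ℕ.+ k ℕ.+ suc (l ℕ.+ s) ≡ 2 ℕ.* suc (k ℕ.+ l) ℕ.+ s
      j-split = solve-∀
      cancel : ∀ M K P → - (M + K + P) + M - 1ℚ + K ≡ - (1ℚ + P)
      cancel = Ring.solve-∀ ringℚ
    c-eq : c + ofℕ k ≡ - Q
    c-eq = trans (cong (λ x → - x + ofℕ k) (ofℕ-split k (suc (suc (k ℕ.+ (l ℕ.+ (l ℕ.+ s))))) (j-split k l s)))
                 (cancel (ofℕ k) Q)
      where
      j-split : ∀ k l s → k ℕ.+ suc (suc (k ℕ.+ (l ℕ.+ (l ℕ.+ s)))) ≡ 2 ℕ.* suc (k ℕ.+ l) ℕ.+ s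
      j-split = solve-∀
      cancel : ∀ K Q → - (K + Q) + K ≡ - Q
      cancel = Ring.solve-∀ ringℚ
    regroup : ∀ L₁ L₂ z iQ iK → (- L₁) * (- L₂) * z * (- iQ) * iK ≡ - z * L₁ * L₂ * (iQ * iK)
    regroup = Ring.solve-∀ ringℚ

  prefactor≡ballot : ∀ m s → prefactor m s ≡ powℚ (- 1ℚ) m * ofℕ (ballot m s)
  prefactor≡ballot m s = begin
    prefactor m s
      ≡⟨ /suc≡*inv numerator (j ∸ m) ⟩
    fromℤ numerator * inv (ofℕ (suc (j ∸ m)))
      ≡⟨ cong₂ (λ x y → x * inv (ofℕ (suc y))) numerator≡ j∸m≡m+s ⟩
    powℚ (- 1ℚ) m * (ofℕ (j C m) * ofℕ (suc s)) * inv N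
      ≡⟨ cong (λ x → powℚ (- 1ℚ) m * x * inv N) binomial≡ballot ⟩
    powℚ (- 1ℚ) m * (ofℕ (ballot m s) * N) * inv N
      ≡⟨ regroup (powℚ (- 1ℚ) m) (ofℕ (ballot m s)) N (inv N) ⟩
    powℚ (- 1ℚ) m * ofℕ (ballot m s) * (N * inv N)
      ≡⟨ cong (powℚ (- 1ℚ) m * ofℕ (ballot m s) *_) (inv-inverseʳ (ofℕ-suc≢0 (m ℕ.+ s))) ⟩
    powℚ (- 1ℚ) m * ofℕ (ballot m s) * 1ℚ
      ≡⟨ ℚ.*-identityʳ _ ⟩
    powℚ (- 1ℚ) m * ofℕ (ballot m s)  ∎
    where
    j = 2 ℕ.* m ℕ.+ s
    N = ofℕ (suc (m ℕ.+ s))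
    sign = (ℤ.- ℤ.1ℤ) ℤ.^ suc m
    linear = (ℤ.- + j) ℤ.+ + (2 ℕ.* m)
    numerator = sign ℤ.* + (j C m) ℤ.* (linear ℤ.- ℤ.1ℤ)
    j≡m+[m+s] : j ≡ m ℕ.+ (m ℕ.+ s)
    j≡m+[m+s] = double m s
      where
      double : ∀ m s → 2 ℕ.* m ℕ.+ s ≡ m ℕ.+ (m ℕ.+ s)
      double = solve-∀
    j∸m≡m+s : j ∸ m ≡ m ℕ.+ s
    j∸m≡m+s = trans (cong (_∸ m) j≡m+[m+s]) (ℕ.m+n∸m≡n m (m ℕ.+ s))
    numerator≡ : fromℤ numerator ≡ powℚ (- 1ℚ) m * (ofℕ (j C m) * ofℕ (suc s))
    numerator≡ = begin
      fromℤ numerator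
        ≡⟨ trans (fromℤ-* (sign ℤ.* + (j C m)) (linear ℤ.- ℤ.1ℤ))
                 (cong₂ _*_ (trans (fromℤ-* sign (+ (j C m))) (cong (_* ofℕ (j C m)) (fromℤ-^ (ℤ.- ℤ.1ℤ) (suc m))))
                            (fromℤ-+ linear (ℤ.- ℤ.1ℤ))) ⟩
      powℚ (- 1ℚ) (suc m) * ofℕ (j C m) * (fromℤ (ℤ.- + j ℤ.+ + (2 ℕ.* m)) + - 1ℚ)
        ≡⟨ cong (λ x → powℚ (- 1ℚ) (suc m) * ofℕ (j C m) * (x + - 1ℚ))
                (trans (fromℤ-+ (ℤ.- + j) (+ (2 ℕ.* m)))
                       (cong (_+ ofℕ (2 ℕ.* m)) (trans (fromℤ-neg (+ j)) (cong -_ (ofℕ-+ (2 ℕ.* m) s))))) ⟩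
      powℚ (- 1ℚ) (suc m) * ofℕ (j C m) * (- (ofℕ (2 ℕ.* m) + ofℕ s) + ofℕ (2 ℕ.* m) + - 1ℚ)
        ≡⟨ simplify (powℚ (- 1ℚ) m) (ofℕ (j C m)) (ofℕ (2 ℕ.* m)) (ofℕ s) ⟩
      powℚ (- 1ℚ) m * (ofℕ (j C m) * (1ℚ + ofℕ s))
        ≡⟨ cong (λ x → powℚ (- 1ℚ) m * (ofℕ (j C m) * x)) (sym (ofℕ-+ 1 s)) ⟩
      powℚ (- 1ℚ) m * (ofℕ (j C m) * ofℕ (suc s))  ∎
      where
      simplify : ∀ p c t s → - 1ℚ * p * c * (- (t + s) + t + - 1ℚ) ≡ p * (c * (1ℚ + s))
      simplify = Ring.solve-∀ ringℚ
    binomial≡ballot : ofℕ (j C m) * ofℕ (suc s) ≡ ofℕ (ballot m s) * N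
    binomial≡ballot = begin
      ofℕ (j C m) * ofℕ (suc s)                 ≡⟨ sym (ofℕ-* (j C m) (suc s)) ⟩
      ofℕ ((j C m) ℕ.* suc s)                   ≡⟨ cong (λ x → ofℕ ((x C m) ℕ.* suc s)) j≡m+[m+s] ⟩
      ofℕ (((m ℕ.+ (m ℕ.+ s)) C m) ℕ.* suc s)   ≡⟨ cong ofℕ (sym (ballot-closed m s)) ⟩
      ofℕ (ballot m s ℕ.* suc (m ℕ.+ s))        ≡⟨ ofℕ-* (ballot m s) (suc (m ℕ.+ s)) ⟩
      ofℕ (ballot m s) * N                      ∎
    regroup : ∀ p d n i → p * (d * n) * i ≡ p * d * (n * i)
    regroup = Ring.solve-∀ ringℚ

  prefactor*hyp-term≡uTerm : ∀ m s k l → k ℕ.+ l ≡ m → prefactor m s * hyp-term m s k ≡ uTerm k l s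
  prefactor*hyp-term≡uTerm m s zero l refl =
    trans (ℚ.*-identityʳ (prefactor l s)) (trans (prefactor≡ballot l s) (pad (powℚ (- 1ℚ) l) (ofℕ (ballot l s))))
    where
    pad : ∀ p d → p * d ≡ 1ℚ * p * 1ℚ * d
    pad = Ring.solve-∀ ringℚ
  prefactor*hyp-term≡uTerm m s (suc k) l refl = begin
    prefactor m s * hyp-term m s (suc k)    ≡⟨ cong (prefactor m s *_) (hyp-term-ratio k l s) ⟩
    prefactor m s * (hyp-term m s k * ρ)    ≡⟨ sym (ℚ.*-assoc (prefactor m s) (hyp-term m s k) ρ) ⟩
    prefactor m s * hyp-term m s k * ρ      ≡⟨ cong (_* ρ) (prefactor*hyp-term≡uTerm m s k (suc l) (ℕ.+-suc k l)) ⟩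
    uTerm k (suc l) s * ρ                   ≡⟨ sym (uTerm-suc k l s) ⟩
    uTerm (suc k) l s                       ∎
    where
    ρ = - z * ofℕ (suc l) * ofℕ (suc (suc (l ℕ.+ s))) * inv (ofℕ (suc (suc (k ℕ.+ (l ℕ.+ (l ℕ.+ s))))) * ofℕ (suc k))

  coeff≡uCoeff : ∀ m s → coeff (2 ℕ.* m ℕ.+ s) m ≡ uCoeff m s
  coeff≡uCoeff m s = begin
    coeff (2 ℕ.* m ℕ.+ s) m                             ≡⟨ coeff≡prefactor*sum m s ⟩
    prefactor m s * sumToℚ m (hyp-term m s)             ≡⟨ sumToℚ-*ˡ (prefactor m s) m (hyp-term m s) ⟩
    sumToℚ m (λ k → prefactor m s * hyp-term m s k)     ≡⟨ sumToℚ-cong m (λ {k} k≤m →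
                                                             prefactor*hyp-term≡uTerm m s k (m ∸ k) (ℕ.m+[n∸m]≡n k≤m)) ⟩
    uCoeff m s                                          ∎

module CoefficientRecurrence where

  open import Data.Nat as ℕ using (ℕ; zero; suc; _∸_)
  import Data.Nat.Properties as ℕ
  open import Data.Nat.Combinatorics using (_C_; nCk+nC[k+1]≡[n+1]C[k+1]; k>n⇒nCk≡0)
  open import Data.Nat.Tactic.RingSolver using (solve-∀)
  open import Data.Rational as ℚ using (ℚ; 0ℚ; 1ℚ; _+_; _*_; -_; _-_)
  import Data.Rational.Properties as ℚ
  open Rational
  open Sums
  open Ballot
  open Evaluation
  open ≡-Reasoning

  -- Supplies the terms of negative index, taken to be 0, in the coefficient recurrences.
  prev : (ℕ → ℚ) → ℕ → ℚ
  prev f zero = 0ℚ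
  prev f (suc n) = f n

  private
    uTerm-at : ∀ k l s {N} → k ℕ.+ (l ℕ.+ (l ℕ.+ s)) ≡ N →
      uTerm k l s ≡ powℚ z k * powℚ (- 1ℚ) l * ofℕ (N C k) * ofℕ (ballot l s)
    uTerm-at k l s refl = refl

    ofℕ-pascal : ∀ n k → ofℕ (suc n C suc k) ≡ ofℕ (n C k) + ofℕ (n C suc k)
    ofℕ-pascal n k = trans (cong ofℕ (sym (nCk+nC[k+1]≡[n+1]C[k+1] n k))) (ofℕ-+ (n C k) (n C suc k))

  uTerm-rec : ∀ k l s → uTerm k l (suc s)
    ≡ uTerm k l s - prev (λ l → uTerm k l (suc (suc s))) l + z * prev (λ k → uTerm k l (suc s)) k
  uTerm-rec zero zero s = refl
  uTerm-rec zero (suc l) s = begin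
    1ℚ * (- 1ℚ * S) * 1ℚ * ofℕ (ballot (suc l) s ℕ.+ ballot l (suc (suc s)))
      ≡⟨ cong (1ℚ * (- 1ℚ * S) * 1ℚ *_) (ofℕ-+ (ballot (suc l) s) (ballot l (suc (suc s)))) ⟩
    1ℚ * (- 1ℚ * S) * 1ℚ * (d₁ + d₂)
      ≡⟨ expand z S d₁ d₂ ⟩
    1ℚ * (- 1ℚ * S) * 1ℚ * d₁ - 1ℚ * S * 1ℚ * d₂ + z * 0ℚ  ∎
    where
    S = powℚ (- 1ℚ) l
    d₁ = ofℕ (ballot (suc l) s)
    d₂ = ofℕ (ballot l (suc (suc s)))
    expand : ∀ z S d₁ d₂ →
      1ℚ * (- 1ℚ * S) * 1ℚ * (d₁ + d₂) ≡ 1ℚ * (- 1ℚ * S) * 1ℚ * d₁ - 1ℚ * S * 1ℚ * d₂ + z * 0ℚ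
    expand = Ring.solve-∀ ringℚ
  uTerm-rec (suc k) zero s = begin
    uTerm (suc k) 0 (suc s)
      ≡⟨ uTerm-at (suc k) 0 (suc s) (cong suc (ℕ.+-suc k s)) ⟩
    z * Z * 1ℚ * ofℕ (suc N C suc k) * 1ℚ
      ≡⟨ cong (λ x → z * Z * 1ℚ * x * 1ℚ) (ofℕ-pascal N k) ⟩
    z * Z * 1ℚ * (b₁ + b₂) * 1ℚ
      ≡⟨ expand z Z b₁ b₂ ⟩
    z * Z * 1ℚ * b₂ * 1ℚ - 0ℚ + z * (Z * 1ℚ * b₁ * 1ℚ)
      ≡⟨ cong (λ x → z * Z * 1ℚ * b₂ * 1ℚ - 0ℚ + z * x) (sym (uTerm-at k 0 (suc s) (ℕ.+-suc k s))) ⟩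
    uTerm (suc k) 0 s - 0ℚ + z * uTerm k 0 (suc s)  ∎
    where
    N = suc (k ℕ.+ s)
    Z = powℚ z k
    b₁ = ofℕ (N C k)
    b₂ = ofℕ (N C suc k)
    expand : ∀ z Z b₁ b₂ →
      z * Z * 1ℚ * (b₁ + b₂) * 1ℚ ≡ z * Z * 1ℚ * b₂ * 1ℚ - 0ℚ + z * (Z * 1ℚ * b₁ * 1ℚ)
    expand = Ring.solve-∀ ringℚ
  uTerm-rec (suc k) (suc l) s = begin
    uTerm (suc k) (suc l) (suc s)
      ≡⟨ uTerm-at (suc k) (suc l) (suc s) (index₀ k l s) ⟩
    z * Z * (- 1ℚ * S) * ofℕ (suc N C suc k) * ofℕ (ballot (suc l) s ℕ.+ ballot l (suc (suc s)))
      ≡⟨ cong₂ (λ x y → z * Z * (- 1ℚ * S) * x * y) (ofℕ-pascal N k) (ofℕ-+ (ballot (suc l) s) (ballot l (suc (suc s)))) ⟩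
    z * Z * (- 1ℚ * S) * (b₁ + b₂) * (d₁ + d₂)
      ≡⟨ expand z Z S b₁ b₂ d₁ d₂ ⟩
    z * Z * (- 1ℚ * S) * b₂ * d₁ - z * Z * S * b₂ * d₂ + z * (Z * (- 1ℚ * S) * b₁ * (d₁ + d₂))
      ≡⟨ cong₂ (λ x y → z * Z * (- 1ℚ * S) * b₂ * d₁ - x + z * y)
               (sym (uTerm-at (suc k) l (suc (suc s)) (index₁ k l s)))
               (trans (cong (Z * (- 1ℚ * S) * b₁ *_) (sym (ofℕ-+ (ballot (suc l) s) (ballot l (suc (suc s))))))
                      (sym (uTerm-at k (suc l) (suc s) (index₂ k l s)))) ⟩
    uTerm (suc k) (suc l) s - uTerm (suc k) l (suc (suc s)) + z * uTerm k (suc l) (suc s)  ∎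
    where
    N = suc k ℕ.+ (suc l ℕ.+ (suc l ℕ.+ s))
    Z = powℚ z k
    S = powℚ (- 1ℚ) l
    b₁ = ofℕ (N C k)
    b₂ = ofℕ (N C suc k)
    d₁ = ofℕ (ballot (suc l) s)
    d₂ = ofℕ (ballot l (suc (suc s)))
    index₀ : ∀ k l s → suc k ℕ.+ (suc l ℕ.+ (suc l ℕ.+ suc s)) ≡ suc (suc k ℕ.+ (suc l ℕ.+ (suc l ℕ.+ s)))
    index₀ = solve-∀
    index₁ : ∀ k l s → suc k ℕ.+ (l ℕ.+ (l ℕ.+ suc (suc s))) ≡ suc k ℕ.+ (suc l ℕ.+ (suc l ℕ.+ s))
    index₁ = solve-∀
    index₂ : ∀ k l s → k ℕ.+ (suc l ℕ.+ (suc l ℕ.+ suc s)) ≡ suc k ℕ.+ (suc l ℕ.+ (suc l ℕ.+ s))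
    index₂ = solve-∀
    expand : ∀ z Z S b₁ b₂ d₁ d₂ → z * Z * (- 1ℚ * S) * (b₁ + b₂) * (d₁ + d₂)
      ≡ z * Z * (- 1ℚ * S) * b₂ * d₁ - z * Z * S * b₂ * d₂ + z * (Z * (- 1ℚ * S) * b₁ * (d₁ + d₂))
    expand = Ring.solve-∀ ringℚ

  uTerm-rec₀ : ∀ k l {n} → k ℕ.+ l ≡ suc n →
    uTerm k l 0 ≡ - prev (λ l → uTerm k l 1) l + z * prev (λ k → uTerm k l 0) k
  uTerm-rec₀ zero (suc l) _ = expand z (powℚ (- 1ℚ) l) (ofℕ (ballot l 1))
    where
    expand : ∀ z S d → 1ℚ * (- 1ℚ * S) * 1ℚ * d ≡ - (1ℚ * S * 1ℚ * d) + z * 0ℚ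
    expand = Ring.solve-∀ ringℚ
  uTerm-rec₀ (suc k) zero _ = begin
    z * Z * 1ℚ * ofℕ (suc (k ℕ.+ 0) C suc k) * 1ℚ
      ≡⟨ cong (λ x → z * Z * 1ℚ * x * 1ℚ) (ofℕ-pascal (k ℕ.+ 0) k) ⟩
    z * Z * 1ℚ * (b + ofℕ ((k ℕ.+ 0) C suc k)) * 1ℚ
      ≡⟨ cong (λ n → z * Z * 1ℚ * (b + ofℕ (n C suc k)) * 1ℚ) (ℕ.+-identityʳ k) ⟩
    z * Z * 1ℚ * (b + ofℕ (k C suc k)) * 1ℚ
      ≡⟨ cong (λ x → z * Z * 1ℚ * (b + ofℕ x) * 1ℚ) (k>n⇒nCk≡0 (ℕ.n<1+n k)) ⟩
    z * Z * 1ℚ * (b + 0ℚ) * 1ℚ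
      ≡⟨ expand z Z b ⟩
    - 0ℚ + z * (Z * 1ℚ * b * 1ℚ)  ∎
    where
    Z = powℚ z k
    b = ofℕ ((k ℕ.+ 0) C k)
    expand : ∀ z Z b → z * Z * 1ℚ * (b + 0ℚ) * 1ℚ ≡ - 0ℚ + z * (Z * 1ℚ * b * 1ℚ)
    expand = Ring.solve-∀ ringℚ
  uTerm-rec₀ (suc k) (suc l) _ = begin
    z * Z * (- 1ℚ * S) * ofℕ (suc N C suc k) * d
      ≡⟨ cong (λ x → z * Z * (- 1ℚ * S) * x * d) (ofℕ-pascal N k) ⟩
    z * Z * (- 1ℚ * S) * (b₁ + b₂) * d
      ≡⟨ expand z Z S b₁ b₂ d ⟩
    - (z * Z * S * b₂ * d) + z * (Z * (- 1ℚ * S) * b₁ * d)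
      ≡⟨ cong (λ x → - x + z * (Z * (- 1ℚ * S) * b₁ * d)) (sym (uTerm-at (suc k) l 1 (index k l))) ⟩
    - uTerm (suc k) l 1 + z * uTerm k (suc l) 0  ∎
    where
    N = k ℕ.+ (suc l ℕ.+ (suc l ℕ.+ 0))
    Z = powℚ z k
    S = powℚ (- 1ℚ) l
    b₁ = ofℕ (N C k)
    b₂ = ofℕ (N C suc k)
    d = ofℕ (ballot l 1)
    index : ∀ k l → suc k ℕ.+ (l ℕ.+ (l ℕ.+ 1)) ≡ k ℕ.+ (suc l ℕ.+ (suc l ℕ.+ 0))
    index = solve-∀
    expand : ∀ z Z S b₁ b₂ d → z * Z * (- 1ℚ * S) * (b₁ + b₂) * d ≡ - (z * Z * S * b₂ * d) + z * (Z * (- 1ℚ * S) * b₁ * d)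
    expand = Ring.solve-∀ ringℚ

  private
    sum-prevˡ : ∀ m (g : ℕ → ℕ → ℚ) →
      sumToℚ (suc m) (λ k → prev (g k) (suc m ∸ k)) ≡ sumToℚ m (λ k → g k (m ∸ k))
    sum-prevˡ m g = begin
      sumToℚ m (λ k → prev (g k) (suc m ∸ k)) + prev (g (suc m)) (suc m ∸ suc m)
        ≡⟨ cong₂ _+_ (sumToℚ-cong m (λ {k} k≤m → cong (prev (g k)) (ℕ.+-∸-assoc 1 k≤m)))
                     (cong (prev (g (suc m))) (ℕ.n∸n≡0 m)) ⟩
      sumToℚ m (λ k → g k (m ∸ k)) + 0ℚ
        ≡⟨ ℚ.+-identityʳ _ ⟩
      sumToℚ m (λ k → g k (m ∸ k))  ∎

    sum-prevʳ : ∀ m (g : ℕ → ℕ → ℚ) →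
      sumToℚ (suc m) (λ k → prev (λ k′ → g k′ (suc m ∸ k)) k) ≡ sumToℚ m (λ k → g k (m ∸ k))
    sum-prevʳ m g = trans (sumToℚ-suc m _) (ℚ.+-identityˡ _)

    sum-combination : ∀ n f g h → sumToℚ n (λ k → f k - g k + z * h k) ≡ sumToℚ n f - sumToℚ n g + z * sumToℚ n h
    sum-combination n f g h = begin
      sumToℚ n (λ k → f k - g k + z * h k)
        ≡⟨ sumToℚ-+ n (λ k → f k - g k) (λ k → z * h k) ⟩
      sumToℚ n (λ k → f k - g k) + sumToℚ n (λ k → z * h k)
        ≡⟨ cong₂ _+_ (sumToℚ-- n f g) (sym (sumToℚ-*ˡ z n h)) ⟩
      sumToℚ n f - sumToℚ n g + z * sumToℚ n h  ∎

  uCoeff-rec : ∀ m s → uCoeff (suc m) (suc s) ≡ uCoeff (suc m) s - uCoeff m (suc (suc s)) + z * uCoeff m (suc s)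
  uCoeff-rec m s = begin
    uCoeff (suc m) (suc s)
      ≡⟨ sumToℚ-cong (suc m) (λ {k} _ → uTerm-rec k (suc m ∸ k) s) ⟩
    sumToℚ (suc m) (λ k → uTerm k (suc m ∸ k) s - prev (λ l → uTerm k l (suc (suc s))) (suc m ∸ k)
                                                 + z * prev (λ k′ → uTerm k′ (suc m ∸ k) (suc s)) k)
      ≡⟨ sum-combination (suc m) _ _ _ ⟩
    uCoeff (suc m) s - sumToℚ (suc m) (λ k → prev (λ l → uTerm k l (suc (suc s))) (suc m ∸ k))
                     + z * sumToℚ (suc m) (λ k → prev (λ k′ → uTerm k′ (suc m ∸ k) (suc s)) k)
      ≡⟨ cong₂ (λ x y → uCoeff (suc m) s - x + z * y)
               (sum-prevˡ m (λ k l → uTerm k l (suc (suc s))))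
               (sum-prevʳ m (λ k l → uTerm k l (suc s))) ⟩
    uCoeff (suc m) s - uCoeff m (suc (suc s)) + z * uCoeff m (suc s)  ∎

  uCoeff-rec₀ : ∀ m → uCoeff (suc m) 0 ≡ - uCoeff m 1 + z * uCoeff m 0
  uCoeff-rec₀ m = begin
    uCoeff (suc m) 0
      ≡⟨ sumToℚ-cong (suc m) (λ {k} k≤1+m → uTerm-rec₀ k (suc m ∸ k) (ℕ.m+[n∸m]≡n k≤1+m)) ⟩
    sumToℚ (suc m) (λ k → - prev (λ l → uTerm k l 1) (suc m ∸ k) + z * prev (λ k′ → uTerm k′ (suc m ∸ k) 0) k)
      ≡⟨ sumToℚ-+ (suc m) _ _ ⟩
    sumToℚ (suc m) (λ k → - prev (λ l → uTerm k l 1) (suc m ∸ k))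
      + sumToℚ (suc m) (λ k → z * prev (λ k′ → uTerm k′ (suc m ∸ k) 0) k)
      ≡⟨ cong₂ _+_ (sumToℚ-neg (suc m) _) (sym (sumToℚ-*ˡ z (suc m) _)) ⟩
    - sumToℚ (suc m) (λ k → prev (λ l → uTerm k l 1) (suc m ∸ k))
      + z * sumToℚ (suc m) (λ k → prev (λ k′ → uTerm k′ (suc m ∸ k) 0) k)
      ≡⟨ cong₂ (λ x y → - x + z * y) (sum-prevˡ m (λ k l → uTerm k l 1)) (sum-prevʳ m (λ k l → uTerm k l 0)) ⟩
    - uCoeff m 1 + z * uCoeff m 0  ∎

module LinearRecurrence where

  open import Data.Nat as ℕ using (ℕ; zero; suc)
  open import Data.Nat.Tactic.RingSolver using (solve-∀)
  open import Data.Product using (_×_; _,_; proj₁)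
  open Gaussian
  open ≡-Reasoning

  -- A record rather than a Π-type, so that a, b and u are recovered by unification.
  record Recurrence (a b : ℚi) (u : ℕ → ℚi) : Set where
    constructor recurrence
    field step : ∀ j → u (suc (suc j)) ≡ a ⊗ u (suc j) ⊕ b ⊗ u j
  open Recurrence

  recurrence-unique : ∀ {a b u w} → Recurrence a b u → Recurrence a b w →
    u 0 ≡ w 0 → u 1 ≡ w 1 → ∀ j → u j ≡ w j
  recurrence-unique {a} {b} {u} {w} rec-u rec-w eq₀ eq₁ j = proj₁ (consecutive j)
    where
    consecutive : ∀ j → u j ≡ w j × u (suc j) ≡ w (suc j)
    consecutive zero = eq₀ , eq₁
    consecutive (suc j) with consecutive j
    ... | eq , eq′ = eq′ , trans (step rec-u j) (trans (cong₂ (λ p q → a ⊗ p ⊕ b ⊗ q) eq′ eq) (sym (step rec-w j)))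

  recurrence-cong : ∀ {a b u w} → (∀ j → u j ≡ w j) → Recurrence a b u → Recurrence a b w
  recurrence-cong {a} {b} u≗w rec = recurrence λ j →
    trans (sym (u≗w (suc (suc j)))) (trans (step rec j) (cong₂ (λ p q → a ⊗ p ⊕ b ⊗ q) (u≗w (suc j)) (u≗w j)))

  recurrence-⊗ˡ : ∀ c {a b u} → Recurrence a b u → Recurrence a b (λ j → c ⊗ u j)
  recurrence-⊗ˡ c {a} {b} {u} rec = recurrence λ j →
    trans (cong (c ⊗_) (step rec j)) (distribute c a b (u (suc j)) (u j))
    where
    distribute : ∀ c a b u₁ u₀ → c ⊗ (a ⊗ u₁ ⊕ b ⊗ u₀) ≡ a ⊗ (c ⊗ u₁) ⊕ b ⊗ (c ⊗ u₀)
    distribute = Ring.solve-∀ ringℚi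

  recurrence-scale : ∀ c {a b u} → Recurrence a b u → Recurrence (c ⊗ a) (c ⊗ c ⊗ b) (λ j → c ^ᶜ j ⊗ u j)
  recurrence-scale c {a} {b} {u} rec = recurrence λ j →
    trans (cong (c ⊗ (c ⊗ c ^ᶜ j) ⊗_) (step rec j)) (distribute c (c ^ᶜ j) a b (u (suc j)) (u j))
    where
    distribute : ∀ c p a b u₁ u₀ →
      c ⊗ (c ⊗ p) ⊗ (a ⊗ u₁ ⊕ b ⊗ u₀) ≡ c ⊗ a ⊗ (c ⊗ p ⊗ u₁) ⊕ c ⊗ c ⊗ b ⊗ (p ⊗ u₀)
    distribute = Ring.solve-∀ ringℚi

  fib-rec : Recurrence 𝟙 𝟙 (λ j → fib (j ℕ.+ 1))
  fib-rec = recurrence λ j → cong (𝟙 ⊗ fib (suc j ℕ.+ 1) ⊕_) (sym (⊗-identityˡ (fib (j ℕ.+ 1))))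

  fib-+3 : ∀ n → fib (3 ℕ.+ n) ≡ (𝟙 ⊕ 𝟙) ⊗ fib (1 ℕ.+ n) ⊕ fib n
  fib-+3 n = unfold (fib n) (fib (1 ℕ.+ n))
    where
    unfold : ∀ f₀ f₁ → 𝟙 ⊗ (𝟙 ⊗ f₁ ⊕ f₀) ⊕ f₁ ≡ (𝟙 ⊕ 𝟙) ⊗ f₁ ⊕ f₀
    unfold = Ring.solve-∀ ringℚi

  fib-+6 : ∀ n → fib (6 ℕ.+ n) ≡ (𝟙 ⊕ 𝟙 ⊕ 𝟙 ⊕ 𝟙) ⊗ fib (3 ℕ.+ n) ⊕ fib n
  fib-+6 n = begin
    fib (3 ℕ.+ (3 ℕ.+ n))
      ≡⟨ fib-+3 (3 ℕ.+ n) ⟩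
    (𝟙 ⊕ 𝟙) ⊗ fib (3 ℕ.+ (1 ℕ.+ n)) ⊕ fib (3 ℕ.+ n)
      ≡⟨ cong₂ (λ p q → (𝟙 ⊕ 𝟙) ⊗ p ⊕ q) (fib-+3 (1 ℕ.+ n)) (fib-+3 n) ⟩
    (𝟙 ⊕ 𝟙) ⊗ ((𝟙 ⊕ 𝟙) ⊗ (𝟙 ⊗ f₁ ⊕ f₀) ⊕ f₁) ⊕ ((𝟙 ⊕ 𝟙) ⊗ f₁ ⊕ f₀)
      ≡⟨ collect f₀ f₁ ⟩
    (𝟙 ⊕ 𝟙 ⊕ 𝟙 ⊕ 𝟙) ⊗ ((𝟙 ⊕ 𝟙) ⊗ f₁ ⊕ f₀) ⊕ f₀
      ≡⟨ cong (λ p → (𝟙 ⊕ 𝟙 ⊕ 𝟙 ⊕ 𝟙) ⊗ p ⊕ f₀) (sym (fib-+3 n)) ⟩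
    (𝟙 ⊕ 𝟙 ⊕ 𝟙 ⊕ 𝟙) ⊗ fib (3 ℕ.+ n) ⊕ f₀  ∎
    where
    f₀ = fib n
    f₁ = fib (1 ℕ.+ n)
    collect : ∀ f₀ f₁ → (𝟙 ⊕ 𝟙) ⊗ ((𝟙 ⊕ 𝟙) ⊗ (𝟙 ⊗ f₁ ⊕ f₀) ⊕ f₁) ⊕ ((𝟙 ⊕ 𝟙) ⊗ f₁ ⊕ f₀)
                        ≡ (𝟙 ⊕ 𝟙 ⊕ 𝟙 ⊕ 𝟙) ⊗ ((𝟙 ⊕ 𝟙) ⊗ f₁ ⊕ f₀) ⊕ f₀
    collect = Ring.solve-∀ ringℚi

  fib-triple-rec : Recurrence (𝟙 ⊕ 𝟙 ⊕ 𝟙 ⊕ 𝟙) 𝟙 (λ j → fib (3 ℕ.* j ℕ.+ 3))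
  fib-triple-rec = recurrence λ j → begin
    fib (3 ℕ.* suc (suc j) ℕ.+ 3)
      ≡⟨ cong fib (index₁ j) ⟩
    fib (6 ℕ.+ (3 ℕ.* j ℕ.+ 3))
      ≡⟨ fib-+6 (3 ℕ.* j ℕ.+ 3) ⟩
    (𝟙 ⊕ 𝟙 ⊕ 𝟙 ⊕ 𝟙) ⊗ fib (3 ℕ.+ (3 ℕ.* j ℕ.+ 3)) ⊕ fib (3 ℕ.* j ℕ.+ 3)
      ≡⟨ cong₂ (λ n p → (𝟙 ⊕ 𝟙 ⊕ 𝟙 ⊕ 𝟙) ⊗ fib n ⊕ p) (index₂ j) (sym (⊗-identityˡ _)) ⟩
    (𝟙 ⊕ 𝟙 ⊕ 𝟙 ⊕ 𝟙) ⊗ fib (3 ℕ.* suc j ℕ.+ 3) ⊕ 𝟙 ⊗ fib (3 ℕ.* j ℕ.+ 3)  ∎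
    where
    index₁ : ∀ j → 3 ℕ.* suc (suc j) ℕ.+ 3 ≡ 6 ℕ.+ (3 ℕ.* j ℕ.+ 3)
    index₁ = solve-∀
    index₂ : ∀ j → 3 ℕ.+ (3 ℕ.* j ℕ.+ 3) ≡ 3 ℕ.* suc j ℕ.+ 3
    index₂ = solve-∀

module Series where

  open import Data.Nat as ℕ using (ℕ; zero; suc; _∸_; ⌊_/2⌋; _≤_; z≤n; s≤s)
  import Data.Nat.Properties as ℕ
  open import Data.Nat.Tactic.RingSolver using (solve-∀)
  open import Data.Product using (∃; _,_)
  open import Data.Sum using (_⊎_; inj₁; inj₂)
  open Gaussian
  open LinearRecurrence using (Recurrence; recurrence)
  open Evaluation using (z; uCoeff; coeff≡uCoeff)
  open CoefficientRecurrence using (uCoeff-rec; uCoeff-rec₀)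
  open ≡-Reasoning

  S : ℚi → ℕ → ℚi
  S x j = sumTo ⌊ j /2⌋ (λ m → ι (coeff j m) ⊗ fibPoly (j ∸ 2 ℕ.* m ℕ.+ 1) x)

  κ : ℕ → ℕ → ℚi
  κ m s = ι (uCoeff m s)

  κ-rec : ∀ m s → κ (suc m) (suc s) ≡ κ (suc m) s ⊕ -ᶜ κ m (suc (suc s)) ⊕ ι z ⊗ κ m (suc s)
  κ-rec m s = trans (cong ι (uCoeff-rec m s))
                    (cong (κ (suc m) s ⊕ -ᶜ κ m (suc (suc s)) ⊕_) (ι-* z (uCoeff m (suc s))))

  κ-rec₀ : ∀ m → κ (suc m) 0 ≡ -ᶜ κ m 1 ⊕ ι z ⊗ κ m 0
  κ-rec₀ m = trans (cong ι (uCoeff-rec₀ m)) (cong (-ᶜ κ m 1 ⊕_) (ι-* z (uCoeff m 0)))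

  module _ (x : ℚi) where

    private
      F : ℕ → ℚi
      F n = fibPoly n x

    -- partial N t = Σ_{m ≤ N} uCoeff m (t+2(N−m)) · F_{t+2(N−m)+1}(x); for t ≤ 1 this is S x (2N+t).
    partial : ℕ → ℕ → ℚi
    partial zero t = κ 0 t ⊗ F (suc t)
    partial (suc N) t = partial N (suc (suc t)) ⊕ κ (suc N) t ⊗ F (suc t)

    partial-rec : ∀ N t → partial N (suc (suc t))
      ≡ x ⊗ partial N (suc t) ⊕ ι z ⊗ partial N t ⊕ (κ N (suc t) ⊕ -ᶜ (ι z ⊗ κ N t)) ⊗ F (suc t)
    partial-rec zero t = base x (ι z) (F (suc t)) (F (suc (suc t)))
      where
      base : ∀ x Z f₁ f₂ → 𝟙 ⊗ (x ⊗ f₂ ⊕ f₁) ≡ x ⊗ (𝟙 ⊗ f₂) ⊕ Z ⊗ (𝟙 ⊗ f₁) ⊕ (𝟙 ⊕ -ᶜ (Z ⊗ 𝟙)) ⊗ f₁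
      base = Ring.solve-∀ ringℚi
    partial-rec (suc N) t = begin
      partial N (suc (suc (suc (suc t)))) ⊕ κ (suc N) (suc (suc t)) ⊗ F (suc (suc (suc t)))
        ≡⟨ cong₂ (λ p k → p ⊕ k ⊗ F (suc (suc (suc t)))) (partial-rec N (suc (suc t))) (κ-rec N (suc t)) ⟩
      x ⊗ partial N (suc (suc (suc t))) ⊕ ι z ⊗ partial N (suc (suc t))
        ⊕ (κ N (suc (suc (suc t))) ⊕ -ᶜ (ι z ⊗ κ N (suc (suc t)))) ⊗ F (suc (suc (suc t)))
        ⊕ (κ (suc N) (suc t) ⊕ -ᶜ κ N (suc (suc (suc t))) ⊕ ι z ⊗ κ N (suc (suc t))) ⊗ F (suc (suc (suc t)))
        ≡⟨ regroup x (ι z) (partial N (suc (suc (suc t)))) (partial N (suc (suc t)))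
                   (κ N (suc (suc (suc t)))) (κ N (suc (suc t))) (κ (suc N) (suc t)) (κ (suc N) t)
                   (F (suc t)) (F (suc (suc t))) ⟩
      x ⊗ partial (suc N) (suc t) ⊕ ι z ⊗ partial (suc N) t ⊕ (κ (suc N) (suc t) ⊕ -ᶜ (ι z ⊗ κ (suc N) t)) ⊗ F (suc t)  ∎
      where
      regroup : ∀ x Z p₃ p₂ a b c d f₁ f₂ →
        x ⊗ p₃ ⊕ Z ⊗ p₂ ⊕ (a ⊕ -ᶜ (Z ⊗ b)) ⊗ (x ⊗ f₂ ⊕ f₁) ⊕ (c ⊕ -ᶜ a ⊕ Z ⊗ b) ⊗ (x ⊗ f₂ ⊕ f₁)
          ≡ x ⊗ (p₃ ⊕ c ⊗ f₂) ⊕ Z ⊗ (p₂ ⊕ d ⊗ f₁) ⊕ (c ⊕ -ᶜ (Z ⊗ d)) ⊗ f₁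
      regroup = Ring.solve-∀ ringℚi

    partial-rec-even : ∀ N → partial (suc N) 0 ≡ x ⊗ partial N 1 ⊕ ι z ⊗ partial N 0
    partial-rec-even N = begin
      partial N 2 ⊕ κ (suc N) 0 ⊗ 𝟙
        ≡⟨ cong₂ (λ p k → p ⊕ k ⊗ 𝟙) (partial-rec N 0) (κ-rec₀ N) ⟩
      x ⊗ partial N 1 ⊕ ι z ⊗ partial N 0 ⊕ (κ N 1 ⊕ -ᶜ (ι z ⊗ κ N 0)) ⊗ 𝟙 ⊕ (-ᶜ κ N 1 ⊕ ι z ⊗ κ N 0) ⊗ 𝟙
        ≡⟨ cancel x (ι z) (partial N 1) (partial N 0) (κ N 1) (κ N 0) ⟩
      x ⊗ partial N 1 ⊕ ι z ⊗ partial N 0  ∎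
      where
      cancel : ∀ x Z p₁ p₀ a b →
        x ⊗ p₁ ⊕ Z ⊗ p₀ ⊕ (a ⊕ -ᶜ (Z ⊗ b)) ⊗ 𝟙 ⊕ (-ᶜ a ⊕ Z ⊗ b) ⊗ 𝟙 ≡ x ⊗ p₁ ⊕ Z ⊗ p₀
      cancel = Ring.solve-∀ ringℚi

    partial-rec-odd : ∀ N → partial (suc N) 1 ≡ x ⊗ partial (suc N) 0 ⊕ ι z ⊗ partial N 1
    partial-rec-odd N = begin
      partial N 3 ⊕ κ (suc N) 1 ⊗ F 2
        ≡⟨ cong₂ (λ p k → p ⊕ k ⊗ F 2) (partial-rec N 1) (κ-rec N 0) ⟩
      x ⊗ partial N 2 ⊕ ι z ⊗ partial N 1 ⊕ (κ N 2 ⊕ -ᶜ (ι z ⊗ κ N 1)) ⊗ F 2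
        ⊕ (κ (suc N) 0 ⊕ -ᶜ κ N 2 ⊕ ι z ⊗ κ N 1) ⊗ F 2
        ≡⟨ cancel x (ι z) (partial N 2) (partial N 1) (κ N 2) (κ N 1) (κ (suc N) 0) ⟩
      x ⊗ (partial N 2 ⊕ κ (suc N) 0 ⊗ 𝟙) ⊕ ι z ⊗ partial N 1  ∎
      where
      cancel : ∀ x Z p₂ p₁ a b c →
        x ⊗ p₂ ⊕ Z ⊗ p₁ ⊕ (a ⊕ -ᶜ (Z ⊗ b)) ⊗ (x ⊗ 𝟙 ⊕ 𝟘) ⊕ (c ⊕ -ᶜ a ⊕ Z ⊗ b) ⊗ (x ⊗ 𝟙 ⊕ 𝟘)
          ≡ x ⊗ (p₂ ⊕ c ⊗ 𝟙) ⊕ Z ⊗ p₁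
      cancel = Ring.solve-∀ ringℚi

    sum≡partial : ∀ N t →
      sumTo N (λ m → ι (coeff (2 ℕ.* N ℕ.+ t) m) ⊗ F (2 ℕ.* N ℕ.+ t ∸ 2 ℕ.* m ℕ.+ 1)) ≡ partial N t
    sum≡partial zero t = cong₂ _⊗_ (cong ι (coeff≡uCoeff 0 t)) (cong F (ℕ.+-comm t 1))
    sum≡partial (suc N) t = cong₂ _⊕_
      (trans (cong (λ j → sumTo N (λ m → ι (coeff j m) ⊗ F (j ∸ 2 ℕ.* m ℕ.+ 1))) (index N t))
             (sum≡partial N (suc (suc t))))
      (cong₂ _⊗_ (cong ι (coeff≡uCoeff (suc N) t))
                 (cong F (trans (cong (ℕ._+ 1) (ℕ.m+n∸m≡n (2 ℕ.* suc N) t)) (ℕ.+-comm t 1))))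
      where
      index : ∀ N t → 2 ℕ.* suc N ℕ.+ t ≡ 2 ℕ.* N ℕ.+ suc (suc t)
      index = solve-∀

    S≡partial : ∀ j N t → j ≡ 2 ℕ.* N ℕ.+ t → t ≤ 1 → S x j ≡ partial N t
    S≡partial _ N t refl t≤1 =
      trans (cong (λ n → sumTo n (λ m → ι (coeff (2 ℕ.* N ℕ.+ t) m) ⊗ F (2 ℕ.* N ℕ.+ t ∸ 2 ℕ.* m ℕ.+ 1)))
                  (half N t≤1))
            (sum≡partial N t)
      where
      half : ∀ N {t} → t ≤ 1 → ⌊ 2 ℕ.* N ℕ.+ t /2⌋ ≡ N
      half zero z≤n = refl
      half zero (s≤s z≤n) = refl
      half (suc N) {t} t≤1 = trans (cong ⌊_/2⌋ (index N t)) (cong suc (half N t≤1))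
        where
        index : ∀ N t → 2 ℕ.* suc N ℕ.+ t ≡ suc (suc (2 ℕ.* N ℕ.+ t))
        index = solve-∀

  private
    parity : ∀ j → ∃ λ N → j ≡ 2 ℕ.* N ℕ.+ 0 ⊎ j ≡ 2 ℕ.* N ℕ.+ 1
    parity zero = 0 , inj₁ refl
    parity (suc j) with parity j
    ... | N , inj₁ refl = N , inj₂ (even→odd N)
      where
      even→odd : ∀ N → suc (2 ℕ.* N ℕ.+ 0) ≡ 2 ℕ.* N ℕ.+ 1
      even→odd = solve-∀
    ... | N , inj₂ refl = suc N , inj₁ (odd→even N)
      where
      odd→even : ∀ N → suc (2 ℕ.* N ℕ.+ 1) ≡ 2 ℕ.* suc N ℕ.+ 0
      odd→even = solve-∀

  module _ (x : ℚi) {u : ℕ → ℚi} (u≡partial : ∀ j N t → j ≡ 2 ℕ.* N ℕ.+ t → t ≤ 1 → u j ≡ partial x N t) where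

    partial-rec⇒rec : Recurrence x (ι z) u
    partial-rec⇒rec = recurrence step
      where
      step : ∀ j → u (suc (suc j)) ≡ x ⊗ u (suc j) ⊕ ι z ⊗ u j
      step j with parity j
      ... | N , inj₁ refl = begin
        u (suc (suc (2 ℕ.* N ℕ.+ 0)))               ≡⟨ u≡partial _ (suc N) 0 (index₁ N) z≤n ⟩
        partial x (suc N) 0                         ≡⟨ partial-rec-even x N ⟩
        x ⊗ partial x N 1 ⊕ ι z ⊗ partial x N 0     ≡⟨ sym (cong₂ (λ a b → x ⊗ a ⊕ ι z ⊗ b)
                                                          (u≡partial _ N 1 (index₂ N) (s≤s z≤n))
                                                          (u≡partial _ N 0 refl z≤n)) ⟩
        x ⊗ u (suc (2 ℕ.* N ℕ.+ 0)) ⊕ ι z ⊗ u (2 ℕ.* N ℕ.+ 0)  ∎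
        where
        index₁ : ∀ N → suc (suc (2 ℕ.* N ℕ.+ 0)) ≡ 2 ℕ.* suc N ℕ.+ 0
        index₁ = solve-∀
        index₂ : ∀ N → suc (2 ℕ.* N ℕ.+ 0) ≡ 2 ℕ.* N ℕ.+ 1
        index₂ = solve-∀
      ... | N , inj₂ refl = begin
        u (suc (suc (2 ℕ.* N ℕ.+ 1)))               ≡⟨ u≡partial _ (suc N) 1 (index₁ N) (s≤s z≤n) ⟩
        partial x (suc N) 1                         ≡⟨ partial-rec-odd x N ⟩
        x ⊗ partial x (suc N) 0 ⊕ ι z ⊗ partial x N 1 ≡⟨ sym (cong₂ (λ a b → x ⊗ a ⊕ ι z ⊗ b)
                                                          (u≡partial _ (suc N) 0 (index₂ N) z≤n)
                                                          (u≡partial _ N 1 refl (s≤s z≤n))) ⟩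
        x ⊗ u (suc (2 ℕ.* N ℕ.+ 1)) ⊕ ι z ⊗ u (2 ℕ.* N ℕ.+ 1)  ∎
        where
        index₁ : ∀ N → suc (suc (2 ℕ.* N ℕ.+ 1)) ≡ 2 ℕ.* suc N ℕ.+ 1
        index₁ = solve-∀
        index₂ : ∀ N → suc (2 ℕ.* N ℕ.+ 1) ≡ 2 ℕ.* suc N ℕ.+ 0
        index₂ = solve-∀

  S-rec : ∀ x → Recurrence x (ι z) (S x)
  S-rec x = partial-rec⇒rec x (S≡partial x)

open Gaussian using (⊗-assoc)
open Evaluation using (z)
open Series using (S; S-rec)
open LinearRecurrence

open import Data.Nat using (ℕ; _+_; _*_; _∸_; ⌊_/2⌋)
import Data.Nat.Properties as ℕ
open import Data.Rational using (_/_)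
open import Data.Integer using (+_)
open import Data.Product using (_×_; _,_)

corollary4 : (j : ℕ) →
    (𝕚 ^ᶜ j ⊗ fib (j + 1)
      ≡ ι (ofℕ 2) ^ᶜ j ⊗ sumTo ⌊ j /2⌋ (λ m →
          ι (coeff j m) ⊗ fibPoly (j ∸ 2 * m + 1) (ι (+ 1 / 2) ⊗ 𝕚)))
    ×
    ((-ᶜ 𝕚) ^ᶜ j ⊗ fib (3 * j + 3)
      ≡ ι (ofℕ 2) ^ᶜ (j + 1) ⊗ sumTo ⌊ j /2⌋ (λ m →
          ι (coeff j m) ⊗ fibPoly (j ∸ 2 * m + 1) (-ᶜ (ι (ofℕ 2) ⊗ 𝕚))))
corollary4 j = identity₁ j , identity₂ j
  where
  two = ι (ofℕ 2)
  x₁ = ι (+ 1 / 2) ⊗ 𝕚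
  x₂ = -ᶜ (two ⊗ 𝕚)
  two^[n+1] : ∀ n → two ⊗ (two ^ᶜ n ⊗ S x₂ n) ≡ two ^ᶜ (n + 1) ⊗ S x₂ n
  two^[n+1] n = trans (sym (⊗-assoc two (two ^ᶜ n) (S x₂ n))) (cong (λ k → two ^ᶜ k ⊗ S x₂ n) (ℕ.+-comm 1 n))
  -- The recurrence coefficients on both sides (e.g. 𝕚 ⊗ 𝟙 and two ⊗ x₁) and the two initial values
  -- agree by evaluation in ℚ(i).
  identity₁ : ∀ n → 𝕚 ^ᶜ n ⊗ fib (n + 1) ≡ two ^ᶜ n ⊗ S x₁ n
  identity₁ = recurrence-unique (recurrence-scale 𝕚 fib-rec) (recurrence-scale two (S-rec x₁)) refl refl
  identity₂ : ∀ n → (-ᶜ 𝕚) ^ᶜ n ⊗ fib (3 * n + 3) ≡ two ^ᶜ (n + 1) ⊗ S x₂ n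
  identity₂ = recurrence-unique (recurrence-scale (-ᶜ 𝕚) fib-triple-rec) scaled-rec refl refl
    where
    scaled-rec : Recurrence (two ⊗ x₂) (two ⊗ two ⊗ ι z) (λ n → two ^ᶜ (n + 1) ⊗ S x₂ n)
    scaled-rec = recurrence-cong two^[n+1] (recurrence-⊗ˡ two (recurrence-scale two (S-rec x₂)))
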